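{- Let $r$ be a power of the prime $p$, let $2<m<r-1$ with $p\nmid(m-1)$, and consider a Desarguesian net of order $r$ and degree $m$ with a line $L$ and a point $x$ not on $L$; put $A=x^\perp\cap L$. If $\gcd(r-1,m-2)=1$, then $C_{x,L}=\{x\}\cup A$. If $\gcd(r-1,m-2)=2$, both $L$ and $A$ are invariant under $z\mapsto -z$, and $0\in A$, then $C_{x,L}=\{x,-x\}\cup A$.
   Context: A Desarguesian net of order $r$ and degree $m$: point set $\mathbb{F}_{r^2}$; fix $S\subseteq\mathbb{F}_{r^2}^*$, a union of $m$ cosets of $\mathbb{F}_r^*$ in $\mathbb{F}_{r^2}^*$; lines are the sets $a+d\,\mathbb{F}_r$ with $a\in\mathbb{F}_{r^2}$, $d\in S$; the collinearity graph has vertex set $\mathbb{F}_{r^2}$, distinct vertices adjacent iff their difference lies in $S$. For a vertex $y$, $y^\perp$ is $\{y\}$ together with its neighbours. For a line $L$ and a point $x\notin L$, $C_{x,L}$ denotes the unique maximal clique of the collinearity graph containing $\{x\}\cup(x^\perp\cap L)$ (existence and uniqueness are known). -}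

module Defs where

open import Level using (0ℓ)
open import Data.Nat as ℕ using (ℕ; zero; suc)
open import Data.Fin using (Fin)
open import Data.Product using (Σ; ∃; _×_; _,_)
open import Data.Sum using (_⊎_)
open import Relation.Nullary using (¬_)
open import Relation.Binary.PropositionalEquality using (_≡_)
open import Algebra.Structures using (IsCommutativeRing)
open import Function.Bundles using (Inverse)
open import Relation.Binary.PropositionalEquality using (setoid)

record FiniteField (n : ℕ) : Set₁ where
  infixl 6 _+_ _-_
  infixl 7 _*_
  infix  8 -_
  field
    Carrier : Set
    _+_ _*_ : Carrier → Carrier → Carrier
    -_      : Carrier → Carrier
    0# 1#   : Carrier
    isCommutativeRing : IsCommutativeRing _≡_ _+_ _*_ -_ 0# 1#
    0≢1     : ¬ (0# ≡ 1#)
    inverse : ∀ x → ¬ (x ≡ 0#) → Σ Carrier (λ y → x * y ≡ 1#)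
    enum    : Inverse (setoid (Fin n)) (setoid Carrier)

  _-_ : Carrier → Carrier → Carrier
  x - y = x + (- y)

  _^_ : Carrier → ℕ → Carrier
  x ^ zero  = 1#
  x ^ suc k = x * (x ^ k)

-- Desarguesian net of order r and degree m, on the field F = F_{r^2}.
module Net (r : ℕ) (F : FiniteField (r ℕ.* r)) where
  open FiniteField F

  InSub : Carrier → Set
  InSub t = t ^ r ≡ t

  SameCoset : Carrier → Carrier → Set
  SameCoset z w = Σ Carrier (λ c → InSub c × ¬ (c ≡ 0#) × z ≡ w * c)

  -- Data of a net of degree m: m coset representatives d i (nonzero,
  -- pairwise in distinct cosets of F_r*); S = ⋃ d i F_r*.
  record Reps (m : ℕ) : Set where
    field
      d        : Fin m → Carrier
      nonzero  : ∀ i → ¬ (d i ≡ 0#)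
      distinct : ∀ i j → SameCoset (d i) (d j) → i ≡ j

  module _ {m : ℕ} (D : Reps m) where
    open Reps D

    InS : Carrier → Set
    InS z = ∃ λ i → SameCoset z (d i)

    Adj : Carrier → Carrier → Set
    Adj y z = ¬ (y ≡ z) × InS (y - z)

    Perp : Carrier → Carrier → Set
    Perp y z = z ≡ y ⊎ Adj y z

    record Line : Set where
      field
        base : Carrier
        dir  : Carrier
        dirS : InS dir

    OnLine : Line → Carrier → Set
    OnLine L z = Σ Carrier (λ t → InSub t × z ≡ Line.base L + Line.dir L * t)

    IsClique : (Carrier → Set) → Set
    IsClique C = ∀ y z → C y → C z → ¬ (y ≡ z) → Adj y z

    IsMaximalClique : (Carrier → Set) → Set
    IsMaximalClique C =
      IsClique C × (∀ z → (∀ y → C y → ¬ (y ≡ z) → Adj y z) → C z)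

    InA : Carrier → Line → Carrier → Set
    InA x L z = Perp x z × OnLine L z

    _≐_ : (Carrier → Set) → (Carrier → Set) → Set
    P ≐ Q = ∀ z → (P z → Q z) × (Q z → P z)

-- Write K for F_r, the fixed field of the involution σ = (_^ r) of F = F_{r²} (σ is additive by the
-- binomial theorem in characteristic p, and involutive by Fermat's little theorem).  With g = x - b,
-- every w ∈ F has unique K-coordinates w = e u + g v, obtained by Cramer's rule from w and σ w.
-- Parametrising L as s ↦ b + e s, the points of A have parameters τ i, one for each direction
-- class other than that of L.
-- Let z ∈ C lie off L and off x, with z - b = e u + g v (so v ≢ 0).  For each a ∈ A the direction
-- z - a lies in S, and the parallel to z a through x meets L again in A; on parameters this is the
-- affine map s ↦ (s - u) / v, so it permutes the finite set T = {τ i}.  Summing over T, if v = 1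
-- then (m - 1) u = 0, so u = 0 and z = x since p ∤ m - 1.  Otherwise the line x z supplies a fixed
-- point of the map in T, and multiplying the differences to it over the other m - 2 elements gives
-- (1/v)^(m-2) = 1; together with (1/v)^(r-1) = 1 this yields (1/v)^gcd(r-1,m-2) = 1.  For gcd 1 that
-- contradicts v ≢ 1.  For gcd 2 it forces v = -1; then composing with the reflection of T through
-- the parameter of 0 ∈ L (which preserves T since A = -A) gives a translation, and summing again
-- pins z down to -x.  Finally -x is adjacent to x and to every point of A, so maximality puts -x in C.

module Submission where

open import Level using (0ℓ)
open import Function using (_∘_; case_of_)
open import Function.Bundles using (Inverse; Injection)
open import Function.Definitions using (Injective)
open import Function.Properties.Inverse using (Inverse⇒Injection)
import Function.Construct.Symmetry as Symmetry
open import Data.Empty using (⊥; ⊥-elim)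
open import Data.Product using (∃; _×_; _,_; _,′_; proj₁; proj₂; map₂)
open import Data.Sum using (_⊎_; inj₁; inj₂; reduce)
open import Data.Maybe using (Maybe; just; nothing)
open import Data.Nat as ℕ using (ℕ; zero; suc; _∸_; _!)
import Data.Nat.Properties as ℕₚ
open import Data.Nat.Divisibility using (_∣_; divides; m∣m*n; ∣1⇒≡1; ∣⇒≤)
open import Data.Nat.DivMod using (m/n*n≡m)
open import Data.Nat.GCD using (gcd; gcd-GCD; gcd[m,n]∣m; gcd[m,n]∣n; module Bézout)
open import Data.Nat.Primality using (Prime; euclidsLemma; prime⇒nonTrivial; prime⇒nonZero; prime⇒irreducible)
open import Data.Nat.Combinatorics using (k![n∸k]!∣n!; nCn≡1) renaming (_C_ to _choose_)
open import Data.Nat.Combinatorics.Specification using (nCk≡n!/k![n-k]!)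
open import Data.Integer as ℤ using (ℤ; -[1+_]; _⊖_) renaming (+_ to ⁺_)
import Data.Integer.Properties as ℤₚ
open import Data.Fin as Fin using (Fin; punchIn; punchOut)
open import Data.Fin.Properties
  using (any?; injective⇒≤; punchIn-injective; punchInᵢ≢i; punchOut-injective; punchIn-punchOut; toℕ-fromℕ; toℕ-inject₁; toℕ<n)
open import Data.Fin.Permutation using (Permutation; permutation)
open import Relation.Nullary using (¬_; Dec; yes; no; contradiction)
import Relation.Nullary.Decidable as Dec
open import Relation.Binary.Definitions using (DecidableEquality)
open import Relation.Binary.PropositionalEquality as ≡ using (_≡_; _≢_)
open import Algebra.Bundles using (Monoid; CommutativeMonoid; CommutativeRing)
import Algebra.Properties.Monoid.Sum as MonoidSum
import Algebra.Properties.Semiring.Exp as SemiringExp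
import Algebra.Properties.CommutativeSemiring.Exp as CommutativeSemiringExp
import Algebra.Properties.CommutativeSemiring.Binomial as CommutativeSemiringBinomial
open import Algebra.Solver.Ring.AlmostCommutativeRing using (fromCommutativeRing; _-Raw-AlmostCommutative⟶_)
import Algebra.Solver.Ring as RingSolver

open import Defs

injective⇒surjective : ∀ {n} (f : Fin n → Fin n) → Injective _≡_ _≡_ f → ∀ j → ∃ λ i → f i ≡ j
injective⇒surjective {suc n} f f-inj j with any? (λ i → f i Fin.≟ j)
... | yes hit = hit
... | no miss = contradiction (injective⇒≤ g-inj) ℕₚ.1+n≰n
  where
  j≢f : ∀ i → j ≢ f i
  j≢f i j≡fi = miss (i , ≡.sym j≡fi)
  g : Fin (suc n) → Fin n
  g i = punchOut (j≢f i)
  g-inj : Injective _≡_ _≡_ g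
  g-inj {a} {b} = f-inj ∘ punchOut-injective (j≢f a) (j≢f b)

injective⇒permutation : ∀ {n} (f : Fin n → Fin n) → Injective _≡_ _≡_ f → Permutation n n
injective⇒permutation f f-inj = permutation f (proj₁ ∘ surj) (proj₂ ∘ surj) (f-inj ∘ proj₂ ∘ surj ∘ f)
  where
  surj : ∀ j → ∃ λ i → f i ≡ j
  surj = injective⇒surjective f f-inj

n∣n! : ∀ n → .{{ℕ.NonZero n}} → n ∣ n !
n∣n! (suc n) = m∣m*n (n !)

prime∣n!⇒p≤n : ∀ {p} → Prime p → ∀ n → p ∣ n ! → p ℕ.≤ n
prime∣n!⇒p≤n p-prime zero    p∣1 = contradiction (∣1⇒≡1 p∣1) (ℕ.nonTrivial⇒≢1 {{prime⇒nonTrivial p-prime}})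
prime∣n!⇒p≤n p-prime (suc n) p∣[1+n]! with euclidsLemma (suc n) (n !) p-prime p∣[1+n]!
... | inj₁ p∣1+n = ∣⇒≤ p∣1+n
... | inj₂ p∣n!  = ℕₚ.m≤n⇒m≤1+n (prime∣n!⇒p≤n p-prime n p∣n!)

prime∣choose : ∀ {p k} → Prime p → 0 ℕ.< k → k ℕ.< p → p ∣ p choose k
prime∣choose {p} {k} p-prime 0<k k<p with euclidsLemma (p choose k) (k ! ℕ.* (p ∸ k) !) p-prime p∣p!
  where
  instance
    _ = k ℕₚ.!* (p ∸ k) !≢0
    _ = prime⇒nonZero p-prime
  k≤p : k ℕ.≤ p
  k≤p = ℕₚ.<⇒≤ k<p
  p∣p! : p ∣ (p choose k) ℕ.* (k ! ℕ.* (p ∸ k) !)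
  p∣p! = ≡.subst (p ∣_) (≡.sym (≡.trans (≡.cong (ℕ._* (k ! ℕ.* (p ∸ k) !)) (nCk≡n!/k![n-k]! k≤p)) (m/n*n≡m (k![n∸k]!∣n! k≤p)))) (n∣n! p)
... | inj₁ p∣pCk = p∣pCk
... | inj₂ p∣k![p∸k]! with euclidsLemma (k !) ((p ∸ k) !) p-prime p∣k![p∸k]!
...   | inj₁ p∣k!     = contradiction (prime∣n!⇒p≤n p-prime k p∣k!) (ℕₚ.<⇒≱ k<p)
...   | inj₂ p∣[p∸k]! = contradiction (prime∣n!⇒p≤n p-prime (p ∸ k) p∣[p∸k]!) (ℕₚ.<⇒≱ (ℕₚ.∸-monoʳ-< 0<k (ℕₚ.<⇒≤ k<p)))

prime∤⇒gcd≡1 : ∀ {p n} → Prime p → ¬ p ∣ n → gcd p n ≡ 1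
prime∤⇒gcd≡1 {p} {n} p-prime p∤n with prime⇒irreducible p-prime (gcd[m,n]∣m p n)
... | inj₁ gcd≡1 = gcd≡1
... | inj₂ gcd≡p = contradiction (≡.subst (_∣ n) gcd≡p (gcd[m,n]∣n p n)) p∤n

Closed : ∀ {a} {A : Set a} {n} → (Fin n → A) → (A → A) → Set a
Closed t f = ∀ i → ∃ λ j → t j ≡ f (t i)

Closed-∘ : ∀ {a} {A : Set a} {n} {t : Fin n → A} {f g} → Closed t f → Closed t g → Closed t (g ∘ f)
Closed-∘ {t = t} {f} {g} f-closed g-closed i with f-closed i
... | j , tj≡fti with g-closed j
...   | k , tk≡gtj = k , ≡.trans tk≡gtj (≡.cong g tj≡fti)

Closed-cong : ∀ {a} {A : Set a} {n} {t : Fin n → A} {f g} → (∀ s → f s ≡ g s) → Closed t f → Closed t g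
Closed-cong f≗g f-closed i with f-closed i
... | j , tj≡fti = j , ≡.trans tj≡fti (f≗g _)

module ClosedFamilySum {c ℓ} (M : CommutativeMonoid c ℓ) where
  open CommutativeMonoid M
  open import Algebra.Properties.CommutativeMonoid.Sum M public using (sum)
  open import Algebra.Properties.CommutativeMonoid.Sum M using (sum-permute; sum-cong-≗; ∑-distrib-+; sum-replicate)
  open import Algebra.Properties.Monoid.Mult monoid using () renaming (_×_ to _·_)
  open import Relation.Binary.Reasoning.Setoid setoid

  sum-∘-injective : ∀ {n} (κ : Fin n → Fin n) → Injective _≡_ _≡_ κ → ∀ h → sum (h ∘ κ) ≈ sum h
  sum-∘-injective κ κ-inj h = sym (sum-permute h (injective⇒permutation κ κ-inj))

  sum-∘-closed : ∀ {n} {t : Fin n → Carrier} {f} → Injective _≡_ _≡_ t → Injective _≡_ _≡_ f →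
                 Closed t f → sum (f ∘ t) ≈ sum t
  sum-∘-closed {n} {t} {f} t-inj f-inj closed = begin
    sum (f ∘ t)  ≡⟨ sum-cong-≗ (proj₂ ∘ closed) ⟨
    sum (t ∘ κ)  ≈⟨ sum-∘-injective κ κ-inj t ⟩
    sum t        ∎
    where
    κ : Fin n → Fin n
    κ = proj₁ ∘ closed
    κ-inj : Injective _≡_ _≡_ κ
    κ-inj {i} {j} κi≡κj = t-inj (f-inj (≡.trans (≡.sym (proj₂ (closed i)))
                                 (≡.trans (≡.cong t κi≡κj) (proj₂ (closed j)))))

  sum-closed-under-∙ : ∀ {n} {t : Fin n → Carrier} {w} → Injective _≡_ _≡_ t →
                       (∀ {a b} → w ∙ a ≡ w ∙ b → a ≡ b) → Closed t (w ∙_) → n · w ∙ sum t ≈ sum t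
  sum-closed-under-∙ {n} {t} {w} t-inj w-inj closed = begin
    n · w ∙ sum t                    ≈⟨ ∙-congʳ (sum-replicate n) ⟨
    sum {n} (λ _ → w) ∙ sum t        ≈⟨ ∑-distrib-+ (λ _ → w) t ⟨
    sum (λ i → w ∙ t i)              ≈⟨ sum-∘-closed t-inj w-inj closed ⟩
    sum t                            ∎

module _ {c ℓ} (M : Monoid c ℓ) where
  open Monoid M
  open import Algebra.Properties.Monoid.Mult M using (×-homo-+; ×-assocˡ; ×-congʳ) renaming (_×_ to _·_)
  open import Relation.Binary.Reasoning.Setoid setoid

  ·-ε : ∀ n → n · ε ≈ ε
  ·-ε zero    = refl
  ·-ε (suc n) = trans (identityˡ _) (·-ε n)

  ·-*-ε : ∀ a b {x} → b · x ≈ ε → (a ℕ.* b) · x ≈ ε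
  ·-*-ε a b {x} bx≈ε = trans (sym (×-assocˡ x a b)) (trans (×-congʳ a bx≈ε) (·-ε a))

  ·-ε-cancel : ∀ d k {x} → k · x ≈ ε → (d ℕ.+ k) · x ≈ ε → d · x ≈ ε
  ·-ε-cancel d k {x} kx≈ε dkx≈ε = begin
    d · x            ≈⟨ identityʳ _ ⟨
    d · x ∙ ε        ≈⟨ ∙-congˡ kx≈ε ⟨
    d · x ∙ k · x    ≈⟨ ×-homo-+ x d k ⟨
    (d ℕ.+ k) · x    ≈⟨ dkx≈ε ⟩
    ε                ∎

  gcd-·-ε : ∀ a b {x} → a · x ≈ ε → b · x ≈ ε → gcd a b · x ≈ ε
  gcd-·-ε a b {x} ax≈ε bx≈ε with Bézout.identity (gcd-GCD a b)
  ... | Bézout.+- u v d+vb≡ua =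
    ·-ε-cancel (gcd a b) (v ℕ.* b) (·-*-ε v b bx≈ε) (≡.subst (λ k → k · x ≈ ε) (≡.sym d+vb≡ua) (·-*-ε u a ax≈ε))
  ... | Bézout.-+ u v d+ua≡vb =
    ·-ε-cancel (gcd a b) (u ℕ.* a) (·-*-ε u a ax≈ε) (≡.subst (λ k → k · x ≈ ε) (≡.sym d+ua≡vb) (·-*-ε v b bx≈ε))

module IntegerCoefficients {c ℓ} (R : CommutativeRing c ℓ) where
  open CommutativeRing R
  open import Algebra.Properties.Ring ring using (-0#≈0#; -‿involutive; -‿distribˡ-*; -‿distribʳ-*; -‿+-comm)
  open import Algebra.Properties.Semiring.Mult.TCOptimised semiring using (×-homo-+; ×1-homo-*) renaming (_×_ to _·_)
  open import Relation.Binary.Reasoning.Setoid setoid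
  open import Algebra.Solver.CommutativeMonoid +-commutativeMonoid using (solve; _⊕_; _⊜_)

  -- The optimised multiple (1 · x = x) makes con (⁺ 1) in solver expressions denote 1# itself.
  ι : ℤ → Carrier
  ι (⁺ n)      = n · 1#
  ι -[1+ n ]   = - (suc n · 1#)

  ι-neg : ∀ i → ι (ℤ.- i) ≈ - ι i
  ι-neg (⁺ zero)  = sym -0#≈0#
  ι-neg (⁺ suc n) = refl
  ι-neg -[1+ n ]  = sym (-‿involutive _)

  ι-⊖ : ∀ m n → ι (m ⊖ n) ≈ m · 1# - n · 1#
  ι-⊖ m       zero    = sym (trans (+-congˡ -0#≈0#) (+-identityʳ _))
  ι-⊖ zero    (suc n) = sym (+-identityˡ _)
  ι-⊖ (suc m) (suc n) = begin
    ι (suc m ⊖ suc n)                     ≡⟨ ≡.cong ι (ℤₚ.[1+m]⊖[1+n]≡m⊖n m n) ⟩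
    ι (m ⊖ n)                             ≈⟨ ι-⊖ m n ⟩
    m · 1# - n · 1#                       ≈⟨ +-congʳ (+-identityˡ _) ⟨
    (0# + m · 1#) - n · 1#                ≈⟨ +-congʳ (+-congʳ (-‿inverseʳ 1#)) ⟨
    ((1# - 1#) + m · 1#) - n · 1#         ≈⟨ solve 4 (λ a b c d → ((a ⊕ b) ⊕ c) ⊕ d ⊜ (a ⊕ c) ⊕ (b ⊕ d)) refl 1# (- 1#) (m · 1#) (- (n · 1#)) ⟩
    (1# + m · 1#) + (- 1# - n · 1#)       ≈⟨ +-congˡ (-‿+-comm 1# (n · 1#)) ⟩
    (1# + m · 1#) - (1# + n · 1#)         ≈⟨ +-cong (×-homo-+ 1# 1 m) (-‿cong (×-homo-+ 1# 1 n)) ⟨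
    suc m · 1# - suc n · 1#               ∎

  ι-+ : ∀ i j → ι (i ℤ.+ j) ≈ ι i + ι j
  ι-+ (⁺ m)    (⁺ n)    = ×-homo-+ 1# m n
  ι-+ (⁺ m)    -[1+ n ] = ι-⊖ m (suc n)
  ι-+ -[1+ m ] (⁺ n)    = trans (ι-⊖ n (suc m)) (+-comm _ _)
  ι-+ -[1+ m ] -[1+ n ] = begin
    - (suc (suc (m ℕ.+ n)) · 1#)     ≡⟨ ≡.cong (λ k → - (suc k · 1#)) (ℕₚ.+-suc m n) ⟨
    - ((suc m ℕ.+ suc n) · 1#)       ≈⟨ -‿cong (×-homo-+ 1# (suc m) (suc n)) ⟩
    - (suc m · 1# + suc n · 1#)      ≈⟨ -‿+-comm _ _ ⟨
    - (suc m · 1#) - suc n · 1#      ∎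

  ι-+* : ∀ m j → ι (⁺ m ℤ.* j) ≈ m · 1# * ι j
  ι-+* m (⁺ n)    = trans (reflexive (≡.cong ι (≡.sym (ℤₚ.pos-* m n)))) (×1-homo-* m n)
  ι-+* m -[1+ n ] = begin
    ι (⁺ m ℤ.* -[1+ n ])              ≡⟨ ≡.cong ι (ℤₚ.neg-distribʳ-* (⁺ m) (⁺ suc n)) ⟨
    ι (ℤ.- (⁺ m ℤ.* ⁺ suc n))         ≈⟨ ι-neg (⁺ m ℤ.* ⁺ suc n) ⟩
    - ι (⁺ m ℤ.* ⁺ suc n)             ≈⟨ -‿cong (ι-+* m (⁺ suc n)) ⟩
    - (m · 1# * suc n · 1#)           ≈⟨ -‿distribʳ-* _ _ ⟩
    m · 1# * - (suc n · 1#)           ∎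

  ι-* : ∀ i j → ι (i ℤ.* j) ≈ ι i * ι j
  ι-* (⁺ m)    j = ι-+* m j
  ι-* -[1+ m ] j = begin
    ι (-[1+ m ] ℤ.* j)                ≡⟨ ≡.cong ι (ℤₚ.neg-distribˡ-* (⁺ suc m) j) ⟨
    ι (ℤ.- (⁺ suc m ℤ.* j))           ≈⟨ ι-neg (⁺ suc m ℤ.* j) ⟩
    - ι (⁺ suc m ℤ.* j)               ≈⟨ -‿cong (ι-+* (suc m) j) ⟩
    - (suc m · 1# * ι j)              ≈⟨ -‿distribˡ-* _ _ ⟩
    - (suc m · 1#) * ι j              ∎

  ι-homomorphism : ℤ.+-*-rawRing -Raw-AlmostCommutative⟶ fromCommutativeRing R
  ι-homomorphism = record
    { ⟦_⟧ = ι ; +-homo = ι-+ ; *-homo = ι-* ; -‿homo = ι-neg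
    ; 0-homo = refl ; 1-homo = refl }

  ι-≟ : ∀ i j → Maybe (ι i ≈ ι j)
  ι-≟ i j with i ℤ.≟ j
  ... | yes ≡.refl = just refl
  ... | no _       = nothing

  open RingSolver ℤ.+-*-rawRing (fromCommutativeRing R) ι-homomorphism ι-≟ public
    using (solve; _:=_; _:+_; _:*_; :-_; _:-_; con)

module FieldProperties {N : ℕ} (F : FiniteField N) where
  open FiniteField F public

  commutativeRing : CommutativeRing 0ℓ 0ℓ
  commutativeRing = record { isCommutativeRing = isCommutativeRing }

  open CommutativeRing commutativeRing public
    using ( +-comm; +-identityˡ; +-identityʳ; -‿inverseˡ; -‿inverseʳ
          ; *-assoc; *-comm; *-identityˡ; *-identityʳ; zeroˡ; zeroʳ
          ; +-monoid; *-monoid; +-commutativeMonoid; *-commutativeMonoid )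
  open import Algebra.Properties.Ring (CommutativeRing.ring commutativeRing) public
    using (-‿involutive; -0#≈0#; +-identityˡ-unique; +-inverseˡ-unique; x∙y⁻¹≈ε⇒x≈y; +-cancelˡ; +-cancelʳ; x+x≈x⇒x≈0)
  open IntegerCoefficients commutativeRing public using (solve; _:=_; _:+_; _:*_; :-_; _:-_; con)
  open import Algebra.Properties.Monoid.Mult +-monoid public using () renaming (_×_ to _·_)
  open import Algebra.Properties.Monoid.Mult +-monoid using (×-homo-1; ×-assocˡ)
  open import Algebra.Properties.Semiring.Mult (CommutativeRing.semiring commutativeRing) using (×-assoc-*; ×1-homo-*)
  module CommutativeExp = CommutativeSemiringExp (CommutativeRing.commutativeSemiring commutativeRing)
  module Exp = SemiringExp (CommutativeRing.semiring commutativeRing)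
  module Binomial = CommutativeSemiringBinomial (CommutativeRing.commutativeSemiring commutativeRing)
  private
    module ∏ = ClosedFamilySum *-commutativeMonoid
    module ∑ where
      open ClosedFamilySum +-commutativeMonoid public
      open MonoidSum +-monoid public using (sum-init-last; sum-cong-≗; sum-replicate-zero)
  open ≡.≡-Reasoning

  enumerate : Fin N → Carrier
  enumerate = Inverse.to enum

  enumerate-injective : Injective _≡_ _≡_ enumerate
  enumerate-injective = Injection.injective (Inverse⇒Injection enum)

  infix 4 _≟_
  _≟_ : DecidableEquality Carrier
  _≟_ = Dec.via-injection (Inverse⇒Injection (Symmetry.inverse enum)) Fin._≟_

  -- Total inverse; the junk value 0# ⁻¹ = 0# lets ⁻¹-distrib-*, ⁻¹-neg and σ-⁻¹ hold unconditionally.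
  infix 30 _⁻¹
  _⁻¹ : Carrier → Carrier
  x ⁻¹ with x ≟ 0#
  ... | yes _   = 0#
  ... | no x≢0 = proj₁ (inverse x x≢0)

  ⁻¹-inverseʳ : ∀ {x} → x ≢ 0# → x * x ⁻¹ ≡ 1#
  ⁻¹-inverseʳ {x} x≢0 with x ≟ 0#
  ... | yes x≡0 = contradiction x≡0 x≢0
  ... | no x≢0′ = proj₂ (inverse x x≢0′)

  ⁻¹-inverseˡ : ∀ {x} → x ≢ 0# → x ⁻¹ * x ≡ 1#
  ⁻¹-inverseˡ {x} x≢0 = ≡.trans (*-comm (x ⁻¹) x) (⁻¹-inverseʳ x≢0)

  0⁻¹ : 0# ⁻¹ ≡ 0#
  0⁻¹ with 0# ≟ 0#
  ... | yes _   = ≡.refl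
  ... | no 0≢0 = contradiction ≡.refl 0≢0

  1≢0 : 1# ≢ 0#
  1≢0 = 0≢1 ∘ ≡.sym

  *-cancelˡ : ∀ {x a b} → x ≢ 0# → x * a ≡ x * b → a ≡ b
  *-cancelˡ {x} {a} {b} x≢0 xa≡xb = begin
    a                ≡⟨ *-identityˡ a ⟨
    1# * a           ≡⟨ ≡.cong (_* a) (⁻¹-inverseˡ x≢0) ⟨
    x ⁻¹ * x * a     ≡⟨ *-assoc _ _ _ ⟩
    x ⁻¹ * (x * a)   ≡⟨ ≡.cong (x ⁻¹ *_) xa≡xb ⟩
    x ⁻¹ * (x * b)   ≡⟨ *-assoc _ _ _ ⟨
    x ⁻¹ * x * b     ≡⟨ ≡.cong (_* b) (⁻¹-inverseˡ x≢0) ⟩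
    1# * b           ≡⟨ *-identityˡ b ⟩
    b                ∎

  *-cancelʳ : ∀ {x a b} → x ≢ 0# → a * x ≡ b * x → a ≡ b
  *-cancelʳ {x} {a} {b} x≢0 ax≡bx = *-cancelˡ x≢0 (≡.trans (*-comm x a) (≡.trans ax≡bx (*-comm b x)))

  *-≢0 : ∀ {x y} → x ≢ 0# → y ≢ 0# → x * y ≢ 0#
  *-≢0 {x} {y} x≢0 y≢0 xy≡0 = y≢0 (*-cancelˡ x≢0 (≡.trans xy≡0 (≡.sym (zeroʳ x))))

  zero-product : ∀ {x y} → x * y ≡ 0# → x ≡ 0# ⊎ y ≡ 0#
  zero-product {x} {y} xy≡0 with x ≟ 0# | y ≟ 0#
  ... | yes x≡0 | _       = inj₁ x≡0
  ... | _       | yes y≡0 = inj₂ y≡0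
  ... | no x≢0  | no y≢0  = contradiction xy≡0 (*-≢0 x≢0 y≢0)

  x*y≡0⇒x≡0 : ∀ {x y} → y ≢ 0# → x * y ≡ 0# → x ≡ 0#
  x*y≡0⇒x≡0 {x} {y} y≢0 xy≡0 = *-cancelʳ y≢0 (≡.trans xy≡0 (≡.sym (zeroˡ y)))

  inverse-unique : ∀ {x y} → x * y ≡ 1# → y ≡ x ⁻¹
  inverse-unique {x} {y} xy≡1 = *-cancelˡ x≢0 (≡.trans xy≡1 (≡.sym (⁻¹-inverseʳ x≢0)))
    where
    x≢0 : x ≢ 0#
    x≢0 x≡0 = 1≢0 (≡.trans (≡.sym xy≡1) (≡.trans (≡.cong (_* y) x≡0) (zeroˡ y)))

  1⁻¹ : 1# ⁻¹ ≡ 1#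
  1⁻¹ = ≡.sym (inverse-unique (*-identityˡ 1#))

  ⁻¹-≢0 : ∀ {x} → x ≢ 0# → x ⁻¹ ≢ 0#
  ⁻¹-≢0 {x} x≢0 x⁻¹≡0 = 1≢0 (≡.trans (≡.sym (⁻¹-inverseʳ x≢0)) (≡.trans (≡.cong (x *_) x⁻¹≡0) (zeroʳ x)))

  ⁻¹-involutive : ∀ x → x ⁻¹ ⁻¹ ≡ x
  ⁻¹-involutive x = case x ≟ 0# of λ where
    (yes x≡0) → ≡.subst (λ y → y ⁻¹ ⁻¹ ≡ y) (≡.sym x≡0) (≡.trans (≡.cong _⁻¹ 0⁻¹) 0⁻¹)
    (no x≢0)  → ≡.sym (inverse-unique (⁻¹-inverseˡ x≢0))

  ⁻¹-distrib-* : ∀ x y → (x * y) ⁻¹ ≡ x ⁻¹ * y ⁻¹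
  ⁻¹-distrib-* x y = case ((x ≟ 0#) ,′ (y ≟ 0#)) of λ where
    (yes x≡0 , _) → ≡.subst (λ x → (x * y) ⁻¹ ≡ x ⁻¹ * y ⁻¹) (≡.sym x≡0) (begin
      (0# * y) ⁻¹    ≡⟨ ≡.cong _⁻¹ (zeroˡ y) ⟩
      0# ⁻¹          ≡⟨ 0⁻¹ ⟩
      0#             ≡⟨ zeroˡ (y ⁻¹) ⟨
      0# * y ⁻¹      ≡⟨ ≡.cong (_* y ⁻¹) 0⁻¹ ⟨
      0# ⁻¹ * y ⁻¹   ∎)
    (_ , yes y≡0) → ≡.subst (λ y → (x * y) ⁻¹ ≡ x ⁻¹ * y ⁻¹) (≡.sym y≡0) (begin
      (x * 0#) ⁻¹    ≡⟨ ≡.cong _⁻¹ (zeroʳ x) ⟩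
      0# ⁻¹          ≡⟨ 0⁻¹ ⟩
      0#             ≡⟨ zeroʳ (x ⁻¹) ⟨
      x ⁻¹ * 0#      ≡⟨ ≡.cong (x ⁻¹ *_) 0⁻¹ ⟨
      x ⁻¹ * 0# ⁻¹   ∎)
    (no x≢0 , no y≢0) → ≡.sym (inverse-unique (begin
      x * y * (x ⁻¹ * y ⁻¹)      ≡⟨ solve 4 (λ x y x′ y′ → x :* y :* (x′ :* y′) := (x :* x′) :* (y :* y′)) ≡.refl x y (x ⁻¹) (y ⁻¹) ⟩
      x * x ⁻¹ * (y * y ⁻¹)      ≡⟨ ≡.cong₂ _*_ (⁻¹-inverseʳ x≢0) (⁻¹-inverseʳ y≢0) ⟩
      1# * 1#                    ≡⟨ *-identityˡ 1# ⟩
      1#                         ∎))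

  ⁻¹-neg : ∀ x → (- x) ⁻¹ ≡ - x ⁻¹
  ⁻¹-neg x = case x ≟ 0# of λ where
    (yes x≡0) → ≡.subst (λ x → (- x) ⁻¹ ≡ - x ⁻¹) (≡.sym x≡0)
                  (≡.trans (≡.cong _⁻¹ -0#≈0#) (≡.trans 0⁻¹ (≡.sym (≡.trans (≡.cong -_ 0⁻¹) -0#≈0#))))
    (no x≢0)  → ≡.sym (inverse-unique (≡.trans (solve 2 (λ x y → (:- x) :* (:- y) := x :* y) ≡.refl x (x ⁻¹)) (⁻¹-inverseʳ x≢0)))

  x-y≡0⇒x≡y : ∀ {x y} → x - y ≡ 0# → x ≡ y
  x-y≡0⇒x≡y = x∙y⁻¹≈ε⇒x≈y _ _

  x*x≡1⇒x≡±1 : ∀ {x} → x * x ≡ 1# → x ≡ 1# ⊎ x ≡ - 1#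
  x*x≡1⇒x≡±1 {x} xx≡1 with zero-product [x-1][x+1]≡0
    where
    [x-1][x+1]≡0 : (x - 1#) * (x + 1#) ≡ 0#
    [x-1][x+1]≡0 = begin
      (x - 1#) * (x + 1#)   ≡⟨ solve 1 (λ x → (x :- con (⁺ 1)) :* (x :+ con (⁺ 1)) := x :* x :- con (⁺ 1)) ≡.refl x ⟩
      x * x - 1#            ≡⟨ ≡.cong (_- 1#) xx≡1 ⟩
      1# - 1#               ≡⟨ -‿inverseʳ 1# ⟩
      0#                    ∎
  ... | inj₁ x-1≡0 = inj₁ (x-y≡0⇒x≡y x-1≡0)
  ... | inj₂ x+1≡0 = inj₂ (+-inverseˡ-unique x 1# x+1≡0)

  ^≡^ : ∀ x n → x ^ n ≡ x Exp.^ n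
  ^≡^ x zero    = ≡.refl
  ^≡^ x (suc n) = ≡.cong (x *_) (^≡^ x n)

  ^-* : ∀ x m n → x ^ (m ℕ.* n) ≡ (x ^ m) ^ n
  ^-* x m n = begin
    x ^ (m ℕ.* n)         ≡⟨ ^≡^ x (m ℕ.* n) ⟩
    x Exp.^ (m ℕ.* n)     ≡⟨ Exp.^-assocʳ x m n ⟨
    (x Exp.^ m) Exp.^ n   ≡⟨ ≡.cong (Exp._^ n) (^≡^ x m) ⟨
    (x ^ m) Exp.^ n       ≡⟨ ^≡^ (x ^ m) n ⟨
    (x ^ m) ^ n           ∎

  ^-distrib-* : ∀ x y n → (x * y) ^ n ≡ x ^ n * y ^ n
  ^-distrib-* x y n = begin
    (x * y) ^ n              ≡⟨ ^≡^ (x * y) n ⟩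
    (x * y) Exp.^ n          ≡⟨ CommutativeExp.^-distrib-* x y n ⟩
    x Exp.^ n * y Exp.^ n    ≡⟨ ≡.cong₂ _*_ (^≡^ x n) (^≡^ y n) ⟨
    x ^ n * y ^ n            ∎

  ^-pred≡1 : ∀ {x} k → x ≢ 0# → x ^ k ≡ x → x ^ (k ∸ 1) ≡ 1#
  ^-pred≡1 zero    x≢0 _     = ≡.refl
  ^-pred≡1 {x} (suc k) x≢0 xᵏ⁺¹≡x = *-cancelˡ x≢0 (≡.trans xᵏ⁺¹≡x (≡.sym (*-identityʳ x)))

  ^-gcd≡1 : ∀ {x} a b → x ^ a ≡ 1# → x ^ b ≡ 1# → x ^ gcd a b ≡ 1#
  ^-gcd≡1 {x} a b xᵃ≡1 xᵇ≡1 = ≡.trans (^≡^ x (gcd a b))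
    (gcd-·-ε *-monoid a b (≡.trans (≡.sym (^≡^ x a)) xᵃ≡1) (≡.trans (≡.sym (^≡^ x b)) xᵇ≡1))

  ∣⇒·≡0 : ∀ {p n} y → p · 1# ≡ 0# → p ∣ n → n · y ≡ 0#
  ∣⇒·≡0 {p} y p·1≡0 (divides c ≡.refl) = begin
    (c ℕ.* p) · y       ≡⟨ ×-assocˡ y c p ⟨
    c · (p · y)         ≡⟨ ≡.cong (c ·_) (≡.trans (×-assoc-* p 1# y) (≡.cong (p ·_) (*-identityˡ y))) ⟨
    c · (p · 1# * y)    ≡⟨ ≡.cong (λ z → c · (z * y)) p·1≡0 ⟩
    c · (0# * y)        ≡⟨ ≡.cong (c ·_) (zeroˡ y) ⟩
    c · 0#              ≡⟨ ·-ε +-monoid c ⟩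
    0#                  ∎

  n·δ≡0⇒δ≡0 : ∀ {n δ} → n · 1# ≢ 0# → n · δ ≡ 0# → δ ≡ 0#
  n·δ≡0⇒δ≡0 {n} {δ} n≢0 nδ≡0 with zero-product (≡.trans (×-assoc-* n 1# δ) (≡.trans (≡.cong (n ·_) (*-identityˡ δ)) nδ≡0))
  ... | inj₁ n≡0 = contradiction n≡0 n≢0
  ... | inj₂ δ≡0 = δ≡0

  ·1-*-≡0 : ∀ m n → (m ℕ.* n) · 1# ≡ 0# → m · 1# ≡ 0# ⊎ n · 1# ≡ 0#
  ·1-*-≡0 m n mn≡0 = zero-product (≡.trans (≡.sym (×1-homo-* m n)) mn≡0)

  prime-power-characteristic : ∀ {p} j → (p ℕ.^ suc j) · 1# ≡ 0# → p · 1# ≡ 0#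
  prime-power-characteristic {p} zero    p¹≡0 with ·1-*-≡0 p 1 p¹≡0
  ... | inj₁ p≡0 = p≡0
  ... | inj₂ 1≡0 = contradiction (≡.trans (≡.sym (×-homo-1 1#)) 1≡0) 1≢0
  prime-power-characteristic {p} (suc j) pʲ⁺²≡0 with ·1-*-≡0 p (p ℕ.^ suc j) pʲ⁺²≡0
  ... | inj₁ p≡0   = p≡0
  ... | inj₂ pʲ⁺¹≡0 = prime-power-characteristic {p} j pʲ⁺¹≡0

  p∤n⇒n·1≢0 : ∀ {p n} → Prime p → p · 1# ≡ 0# → ¬ p ∣ n → n · 1# ≢ 0#
  p∤n⇒n·1≢0 {p} {n} p-prime p·1≡0 p∤n n·1≡0 = 1≢0 (begin
    1#              ≡⟨ ×-homo-1 1# ⟨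
    1 · 1#          ≡⟨ ≡.cong (_· 1#) (prime∤⇒gcd≡1 p-prime p∤n) ⟨
    gcd p n · 1#    ≡⟨ gcd-·-ε +-monoid p n p·1≡0 n·1≡0 ⟩
    0#              ∎)

  ∏-≢0 : ∀ {n} (t : Fin n → Carrier) → (∀ i → t i ≢ 0#) → ∏.sum t ≢ 0#
  ∏-≢0 {zero}  t t≢0 = 1≢0
  ∏-≢0 {suc n} t t≢0 = *-≢0 (t≢0 Fin.zero) (∏-≢0 (t ∘ Fin.suc) (t≢0 ∘ Fin.suc))

  translation-closed⇒n·δ≡0 : ∀ {n} {t : Fin n → Carrier} {δ} → Injective _≡_ _≡_ t → Closed t (δ +_) → n · δ ≡ 0#
  translation-closed⇒n·δ≡0 {δ = δ} t-inj closed =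
    +-identityˡ-unique _ _ (∑.sum-closed-under-∙ t-inj (+-cancelˡ δ _ _) closed)

  dilation-closed⇒μⁿ≡1 : ∀ {n} {t : Fin n → Carrier} {μ} → Injective _≡_ _≡_ t → (∀ i → t i ≢ 0#) → μ ≢ 0# →
                         Closed t (μ *_) → μ ^ n ≡ 1#
  dilation-closed⇒μⁿ≡1 {n} {t} {μ} t-inj t≢0 μ≢0 closed = *-cancelʳ (∏-≢0 t t≢0) (begin
    μ ^ n * ∏.sum t          ≡⟨ ≡.cong (_* ∏.sum t) (^≡^ μ n) ⟩
    μ Exp.^ n * ∏.sum t      ≡⟨ ∏.sum-closed-under-∙ t-inj (*-cancelˡ μ≢0) closed ⟩
    ∏.sum t                  ≡⟨ *-identityˡ _ ⟨
    1# * ∏.sum t             ∎)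

  affine-closed⇒μⁿ⁻¹≡1 : ∀ {n} {t : Fin n → Carrier} {μ β} k → Injective _≡_ _≡_ t → μ ≢ 0# →
                         Closed t (λ s → μ * s + β) → μ * t k + β ≡ t k → μ ^ (n ∸ 1) ≡ 1#
  affine-closed⇒μⁿ⁻¹≡1 {suc n} {t} {μ} {β} k t-inj μ≢0 closed t-k-fixed =
    dilation-closed⇒μⁿ≡1 t′-inj t′≢0 μ≢0 t′-closed
    where
    t′ : Fin n → Carrier
    t′ i = t (punchIn k i) - t k
    about-t-k : ∀ s → μ * s + β - t k ≡ μ * (s - t k)
    about-t-k s = begin
      μ * s + β - t k                 ≡⟨ ≡.cong (_-_ (μ * s + β)) t-k-fixed ⟨
      μ * s + β - (μ * t k + β)       ≡⟨ solve 4 (λ μ s β c → μ :* s :+ β :- (μ :* c :+ β) := μ :* (s :- c)) ≡.refl μ s β (t k) ⟩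
      μ * (s - t k)                   ∎
    t′-inj : Injective _≡_ _≡_ t′
    t′-inj = punchIn-injective k _ _ ∘ t-inj ∘ +-cancelʳ _ _ _
    t′≢0 : ∀ i → t′ i ≢ 0#
    t′≢0 i t′i≡0 = punchInᵢ≢i k i (t-inj (x-y≡0⇒x≡y t′i≡0))
    t′-closed : Closed t′ (μ *_)
    t′-closed i with closed (punchIn k i)
    ... | j , tj≡ = punchOut k≢j , (begin
      t (punchIn k (punchOut k≢j)) - t k   ≡⟨ ≡.cong (λ l → t l - t k) (punchIn-punchOut k≢j) ⟩
      t j - t k                            ≡⟨ tj-t-k ⟩
      μ * t′ i                             ∎)
      where
      tj-t-k : t j - t k ≡ μ * t′ i
      tj-t-k = ≡.trans (≡.cong (_- t k) tj≡) (about-t-k _)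
      k≢j : k ≢ j
      k≢j k≡j = *-≢0 μ≢0 (t′≢0 i) (≡.trans (≡.sym tj-t-k) (≡.trans (≡.cong (λ l → t l - t k) (≡.sym k≡j)) (-‿inverseʳ (t k))))

  characteristic : N · 1# ≡ 0#
  characteristic = translation-closed⇒n·δ≡0 enumerate-injective successor
    where
    successor : Closed enumerate (1# +_)
    successor i = Inverse.from enum (1# + enumerate i) , Inverse.strictlyInverseˡ enum _

  fermat-for : ∀ {n} → Inverse (≡.setoid (Fin n)) (≡.setoid Carrier) → ∀ x → x ^ n ≡ x
  fermat-for {zero}  e _ with () ← Inverse.from e 0#
  fermat-for {suc n} e x with x ≟ 0#
  ... | yes x≡0 = ≡.trans (≡.cong (_^ suc n) x≡0) (≡.trans (zeroˡ _) (≡.sym x≡0))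
  ... | no x≢0  = ≡.trans (≡.cong (x *_) (unit^n≡1 x≢0)) (*-identityʳ x)
    where
    open Inverse e using (to; from; strictlyInverseˡ; strictlyInverseʳ)
    z : Fin (suc n)
    z = from 0#
    t : Fin n → Carrier
    t i = to (punchIn z i)
    t-inj : Injective _≡_ _≡_ t
    t-inj = punchIn-injective z _ _ ∘ Injection.injective (Inverse⇒Injection e)
    t≢0 : ∀ i → t i ≢ 0#
    t≢0 i ti≡0 = punchInᵢ≢i z i (≡.trans (≡.sym (strictlyInverseʳ _)) (≡.cong from ti≡0))
    unit^n≡1 : ∀ {x} → x ≢ 0# → x ^ n ≡ 1#
    unit^n≡1 {x} x≢0 = dilation-closed⇒μⁿ≡1 t-inj t≢0 x≢0 closed
      where
      closed : Closed t (x *_)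
      closed i = punchOut z≢ , ≡.trans (≡.cong to (punchIn-punchOut z≢)) (strictlyInverseˡ _)
        where
        z≢ : z ≢ from (x * t i)
        z≢ z≡ = *-≢0 x≢0 (t≢0 i) (≡.trans (≡.sym (strictlyInverseˡ _)) (≡.trans (≡.cong to (≡.sym z≡)) (strictlyInverseˡ 0#)))

  fermat : ∀ x → x ^ N ≡ x
  fermat = fermat-for enum

  frobenius : ∀ {p} → Prime p → p · 1# ≡ 0# → ∀ a b → (a + b) ^ p ≡ a ^ p + b ^ p
  frobenius {suc (suc q)} p-prime p·1≡0 a b = begin
    (a + b) ^ p                                 ≡⟨ ^≡^ (a + b) p ⟩
    (a + b) Exp.^ p                             ≡⟨ Binomial.theorem p a b ⟩
    term 0 + ∑.sum {p} (term ∘ suc ∘ Fin.toℕ)   ≡⟨ ≡.cong (term 0 +_) (∑.sum-init-last {suc q} (term ∘ suc ∘ Fin.toℕ)) ⟩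
    term 0 + (∑.sum {suc q} (term ∘ suc ∘ Fin.toℕ ∘ Fin.inject₁) + term (suc (Fin.toℕ (Fin.fromℕ (suc q)))))
                                                ≡⟨ ≡.cong₂ (λ u v → term 0 + (u + v)) middle last ⟩
    term 0 + (0# + a ^ p)                       ≡⟨ ≡.cong₂ _+_ first (+-identityˡ (a ^ p)) ⟩
    b ^ p + a ^ p                               ≡⟨ +-comm _ _ ⟩
    a ^ p + b ^ p                               ∎
    where
    p : ℕ
    p = suc (suc q)
    term : ℕ → Carrier
    term k = (p choose k) · (a Exp.^ k * b Exp.^ (p ∸ k))
    first : term 0 ≡ b ^ p
    first = ≡.trans (×-homo-1 _) (≡.trans (*-identityˡ _) (≡.sym (^≡^ b p)))
    last : term (suc (Fin.toℕ (Fin.fromℕ (suc q)))) ≡ a ^ p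
    last = begin
      term (suc (Fin.toℕ (Fin.fromℕ (suc q))))  ≡⟨ ≡.cong (term ∘ suc) (toℕ-fromℕ (suc q)) ⟩
      (p choose p) · (a Exp.^ p * b Exp.^ (p ∸ p))   ≡⟨ ≡.cong₂ (λ c k → c · (a Exp.^ p * b Exp.^ k)) (nCn≡1 p) (ℕₚ.n∸n≡0 p) ⟩
      1 · (a Exp.^ p * 1#)                      ≡⟨ ×-homo-1 _ ⟩
      a Exp.^ p * 1#                            ≡⟨ *-identityʳ _ ⟩
      a Exp.^ p                                 ≡⟨ ^≡^ a p ⟨
      a ^ p                                     ∎
    middle : ∑.sum {suc q} (term ∘ suc ∘ Fin.toℕ ∘ Fin.inject₁) ≡ 0#
    middle = ≡.trans (∑.sum-cong-≗ vanishes) (∑.sum-replicate-zero (suc q))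
      where
      vanishes : ∀ i → term (suc (Fin.toℕ (Fin.inject₁ i))) ≡ 0#
      vanishes i = ∣⇒·≡0 _ p·1≡0 (prime∣choose p-prime (ℕ.s≤s ℕ.z≤n)
        (ℕ.s≤s (≡.subst (ℕ._< suc q) (≡.sym (toℕ-inject₁ i)) (toℕ<n i))))

  frobenius-^ : ∀ {p} → Prime p → p · 1# ≡ 0# → ∀ j a b → (a + b) ^ (p ℕ.^ j) ≡ a ^ (p ℕ.^ j) + b ^ (p ℕ.^ j)
  frobenius-^ p-prime p·1≡0 zero    a b = ≡.trans (*-identityʳ _) (≡.sym (≡.cong₂ _+_ (*-identityʳ a) (*-identityʳ b)))
  frobenius-^ {p} p-prime p·1≡0 (suc j) a b = begin
    (a + b) ^ (p ℕ.* p ℕ.^ j)                     ≡⟨ ^-* (a + b) p (p ℕ.^ j) ⟩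
    ((a + b) ^ p) ^ (p ℕ.^ j)                     ≡⟨ ≡.cong (_^ (p ℕ.^ j)) (frobenius p-prime p·1≡0 a b) ⟩
    (a ^ p + b ^ p) ^ (p ℕ.^ j)                   ≡⟨ frobenius-^ p-prime p·1≡0 j (a ^ p) (b ^ p) ⟩
    (a ^ p) ^ (p ℕ.^ j) + (b ^ p) ^ (p ℕ.^ j)     ≡⟨ ≡.cong₂ _+_ (^-* a p (p ℕ.^ j)) (^-* b p (p ℕ.^ j)) ⟨
    a ^ (p ℕ.* p ℕ.^ j) + b ^ (p ℕ.* p ℕ.^ j)     ∎

  module Involution (σ : Carrier → Carrier)
                    (σ-+ : ∀ a b → σ (a + b) ≡ σ a + σ b)
                    (σ-* : ∀ a b → σ (a * b) ≡ σ a * σ b)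
                    (σ-σ : ∀ a → σ (σ a) ≡ a) where

    Fixed : Carrier → Set
    Fixed a = σ a ≡ a

    σ-0 : σ 0# ≡ 0#
    σ-0 = x+x≈x⇒x≈0 (σ 0#) (≡.trans (≡.sym (σ-+ 0# 0#)) (≡.cong σ (+-identityˡ 0#)))

    σ-neg : ∀ a → σ (- a) ≡ - σ a
    σ-neg a = +-inverseˡ-unique (σ (- a)) (σ a) (≡.trans (≡.sym (σ-+ (- a) a)) (≡.trans (≡.cong σ (-‿inverseˡ a)) σ-0))

    σ-- : ∀ a b → σ (a - b) ≡ σ a - σ b
    σ-- a b = ≡.trans (σ-+ a (- b)) (≡.cong (σ a +_) (σ-neg b))

    σ-≢0 : ∀ {a} → a ≢ 0# → σ a ≢ 0#
    σ-≢0 {a} a≢0 σa≡0 = a≢0 (≡.trans (≡.sym (σ-σ a)) (≡.trans (≡.cong σ σa≡0) σ-0))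

    σ-1 : σ 1# ≡ 1#
    σ-1 = *-cancelˡ (σ-≢0 1≢0) (≡.trans (≡.sym (σ-* 1# 1#)) (≡.trans (≡.cong σ (*-identityʳ 1#)) (≡.sym (*-identityʳ (σ 1#)))))

    σ-⁻¹ : ∀ a → σ (a ⁻¹) ≡ (σ a) ⁻¹
    σ-⁻¹ a = case a ≟ 0# of λ where
      (yes a≡0) → ≡.subst (λ a → σ (a ⁻¹) ≡ (σ a) ⁻¹) (≡.sym a≡0)
                    (≡.trans (≡.cong σ 0⁻¹) (≡.trans σ-0 (≡.trans (≡.sym 0⁻¹) (≡.cong _⁻¹ (≡.sym σ-0)))))
      (no a≢0)  → inverse-unique (≡.trans (≡.sym (σ-* a (a ⁻¹))) (≡.trans (≡.cong σ (⁻¹-inverseʳ a≢0)) σ-1))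

    fixed-0 : Fixed 0#
    fixed-0 = σ-0

    fixed-1 : Fixed 1#
    fixed-1 = σ-1

    fixed-+ : ∀ {a b} → Fixed a → Fixed b → Fixed (a + b)
    fixed-+ {a} {b} σa≡a σb≡b = ≡.trans (σ-+ a b) (≡.cong₂ _+_ σa≡a σb≡b)

    fixed-* : ∀ {a b} → Fixed a → Fixed b → Fixed (a * b)
    fixed-* {a} {b} σa≡a σb≡b = ≡.trans (σ-* a b) (≡.cong₂ _*_ σa≡a σb≡b)

    fixed-neg : ∀ {a} → Fixed a → Fixed (- a)
    fixed-neg {a} σa≡a = ≡.trans (σ-neg a) (≡.cong -_ σa≡a)

    fixed-- : ∀ {a b} → Fixed a → Fixed b → Fixed (a - b)
    fixed-- σa≡a σb≡b = fixed-+ σa≡a (fixed-neg σb≡b)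

    fixed-⁻¹ : ∀ {a} → Fixed a → Fixed (a ⁻¹)
    fixed-⁻¹ {a} σa≡a = ≡.trans (σ-⁻¹ a) (≡.cong _⁻¹ σa≡a)

    σ-cross : ∀ a b c d → σ (a * b - c * d) ≡ σ a * σ b - σ c * σ d
    σ-cross a b c d = ≡.trans (σ-- (a * b) (c * d)) (≡.cong₂ _-_ (σ-* a b) (σ-* c d))

    -- Cramer's rule for w = e u + g v and its conjugate σ w = σ e u + σ g v, with u and v fixed;
    -- the determinant Δ vanishes exactly when g ∈ e · Fixed.
    module Coordinates (e g : Carrier) (e≢0 : e ≢ 0#) (g∉eK : ∀ c → Fixed c → g ≢ e * c) where

      Δ : Carrier
      Δ = e * σ g - g * σ e

      Δ≢0 : Δ ≢ 0#
      Δ≢0 Δ≡0 = g∉eK (g * e ⁻¹) fixed (≡.sym (begin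
        e * (g * e ⁻¹)    ≡⟨ solve 3 (λ e g i → e :* (g :* i) := g :* (e :* i)) ≡.refl e g (e ⁻¹) ⟩
        g * (e * e ⁻¹)    ≡⟨ ≡.cong (g *_) (⁻¹-inverseʳ e≢0) ⟩
        g * 1#            ≡⟨ *-identityʳ g ⟩
        g                 ∎))
        where
        fixed : Fixed (g * e ⁻¹)
        fixed = *-cancelˡ (*-≢0 e≢0 (σ-≢0 e≢0)) (begin
          e * σ e * σ (g * e ⁻¹)      ≡⟨ ≡.cong (e * σ e *_) (≡.trans (σ-* g (e ⁻¹)) (≡.cong (σ g *_) (σ-⁻¹ e))) ⟩
          e * σ e * (σ g * σ e ⁻¹)    ≡⟨ solve 4 (λ e s t i → e :* s :* (t :* i) := e :* t :* (s :* i)) ≡.refl e (σ e) (σ g) (σ e ⁻¹) ⟩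
          e * σ g * (σ e * σ e ⁻¹)    ≡⟨ ≡.cong₂ _*_ (x-y≡0⇒x≡y Δ≡0) (⁻¹-inverseʳ (σ-≢0 e≢0)) ⟩
          g * σ e * 1#                ≡⟨ ≡.cong (g * σ e *_) (⁻¹-inverseʳ e≢0) ⟨
          g * σ e * (e * e ⁻¹)        ≡⟨ solve 4 (λ g s e i → g :* s :* (e :* i) := e :* s :* (g :* i)) ≡.refl g (σ e) e (e ⁻¹) ⟩
          e * σ e * (g * e ⁻¹)        ∎)

      U V : Carrier → Carrier
      U w = (w * σ g - g * σ w) * Δ ⁻¹
      V w = (e * σ w - w * σ e) * Δ ⁻¹

      decompose : ∀ w → e * U w + g * V w ≡ w
      decompose w = begin
        e * U w + g * V w   ≡⟨ solve 7 (λ e g w sw sg se i → e :* ((w :* sg :- g :* sw) :* i) :+ g :* ((e :* sw :- w :* se) :* i)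
                                          := w :* ((e :* sg :- g :* se) :* i)) ≡.refl e g w (σ w) (σ g) (σ e) (Δ ⁻¹) ⟩
        w * (Δ * Δ ⁻¹)      ≡⟨ ≡.cong (w *_) (⁻¹-inverseʳ Δ≢0) ⟩
        w * 1#              ≡⟨ *-identityʳ w ⟩
        w                   ∎

      σ-Δ⁻¹ : σ (Δ ⁻¹) ≡ - Δ ⁻¹
      σ-Δ⁻¹ = begin
        σ (Δ ⁻¹)                          ≡⟨ σ-⁻¹ Δ ⟩
        σ Δ ⁻¹                            ≡⟨ ≡.cong _⁻¹ (σ-cross e (σ g) g (σ e)) ⟩
        (σ e * σ (σ g) - σ g * σ (σ e)) ⁻¹ ≡⟨ ≡.cong₂ (λ a b → (σ e * a - σ g * b) ⁻¹) (σ-σ g) (σ-σ e) ⟩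
        (σ e * g - σ g * e) ⁻¹
          ≡⟨ ≡.cong _⁻¹ (solve 4 (λ e g se sg → se :* g :- sg :* e := :- (e :* sg :- g :* se)) ≡.refl e g (σ e) (σ g)) ⟩
        (- Δ) ⁻¹                          ≡⟨ ⁻¹-neg Δ ⟩
        - Δ ⁻¹                            ∎

      U-fixed : ∀ w → Fixed (U w)
      U-fixed w = begin
        σ ((w * σ g - g * σ w) * Δ ⁻¹)                ≡⟨ ≡.trans (σ-* _ _) (≡.cong₂ _*_ (σ-cross w (σ g) g (σ w)) σ-Δ⁻¹) ⟩
        (σ w * σ (σ g) - σ g * σ (σ w)) * - Δ ⁻¹      ≡⟨ ≡.cong₂ (λ a b → (σ w * a - σ g * b) * - Δ ⁻¹) (σ-σ g) (σ-σ w) ⟩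
        (σ w * g - σ g * w) * - Δ ⁻¹
          ≡⟨ solve 5 (λ w g sw sg i → (sw :* g :- sg :* w) :* (:- i) := (w :* sg :- g :* sw) :* i) ≡.refl w g (σ w) (σ g) (Δ ⁻¹) ⟩
        U w                                           ∎

      V-fixed : ∀ w → Fixed (V w)
      V-fixed w = begin
        σ ((e * σ w - w * σ e) * Δ ⁻¹)                ≡⟨ ≡.trans (σ-* _ _) (≡.cong₂ _*_ (σ-cross e (σ w) w (σ e)) σ-Δ⁻¹) ⟩
        (σ e * σ (σ w) - σ w * σ (σ e)) * - Δ ⁻¹      ≡⟨ ≡.cong₂ (λ a b → (σ e * a - σ w * b) * - Δ ⁻¹) (σ-σ w) (σ-σ e) ⟩
        (σ e * w - σ w * e) * - Δ ⁻¹
          ≡⟨ solve 5 (λ w e sw se i → (se :* w :- sw :* e) :* (:- i) := (e :* sw :- w :* se) :* i) ≡.refl w e (σ w) (σ e) (Δ ⁻¹) ⟩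
        V w                                           ∎

      coordinates-unique : ∀ {w u v} → Fixed u → Fixed v → w ≡ e * u + g * v → U w ≡ u × V w ≡ v
      coordinates-unique {w} {u} {v} σu≡u σv≡v ≡.refl = U-eq , V-eq
        where
        σw : σ w ≡ σ e * u + σ g * v
        σw = ≡.trans (σ-+ _ _) (≡.cong₂ _+_ (≡.trans (σ-* e u) (≡.cong (σ e *_) σu≡u)) (≡.trans (σ-* g v) (≡.cong (σ g *_) σv≡v)))
        U-eq : U w ≡ u
        U-eq = begin
          (w * σ g - g * σ w) * Δ ⁻¹                           ≡⟨ ≡.cong (λ s → (w * σ g - g * s) * Δ ⁻¹) σw ⟩
          ((e * u + g * v) * σ g - g * (σ e * u + σ g * v)) * Δ ⁻¹
            ≡⟨ solve 7 (λ e g u v se sg i → ((e :* u :+ g :* v) :* sg :- g :* (se :* u :+ sg :* v)) :* i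
                        := u :* ((e :* sg :- g :* se) :* i)) ≡.refl e g u v (σ e) (σ g) (Δ ⁻¹) ⟩
          u * (Δ * Δ ⁻¹)                                       ≡⟨ ≡.cong (u *_) (⁻¹-inverseʳ Δ≢0) ⟩
          u * 1#                                               ≡⟨ *-identityʳ u ⟩
          u                                                    ∎
        V-eq : V w ≡ v
        V-eq = begin
          (e * σ w - w * σ e) * Δ ⁻¹                           ≡⟨ ≡.cong (λ s → (e * s - w * σ e) * Δ ⁻¹) σw ⟩
          (e * (σ e * u + σ g * v) - (e * u + g * v) * σ e) * Δ ⁻¹
            ≡⟨ solve 7 (λ e g u v se sg i → (e :* (se :* u :+ sg :* v) :- (e :* u :+ g :* v) :* se) :* i
                        := v :* ((e :* sg :- g :* se) :* i)) ≡.refl e g u v (σ e) (σ g) (Δ ⁻¹) ⟩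
          v * (Δ * Δ ⁻¹)                                       ≡⟨ ≡.cong (v *_) (⁻¹-inverseʳ Δ≢0) ⟩
          v * 1#                                               ≡⟨ *-identityʳ v ⟩
          v                                                    ∎

module FrobeniusOfSquareOrder {p r k} (p-prime : Prime p) (r≡pᵏ⁺¹ : r ≡ p ℕ.^ suc k) (F : FiniteField (r ℕ.* r)) where
  open FieldProperties F

  characteristic-p : p · 1# ≡ 0#
  characteristic-p = prime-power-characteristic {p} k (≡.subst (λ q → q · 1# ≡ 0#) r≡pᵏ⁺¹ r·1≡0)
    where
    r·1≡0 : r · 1# ≡ 0#
    r·1≡0 = reduce (·1-*-≡0 r r characteristic)

  frobenius-+ : ∀ a b → (a + b) ^ r ≡ a ^ r + b ^ r
  frobenius-+ = ≡.subst (λ q → ∀ a b → (a + b) ^ q ≡ a ^ q + b ^ q) (≡.sym r≡pᵏ⁺¹) (frobenius-^ p-prime characteristic-p (suc k))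

  frobenius-involutive : ∀ a → (a ^ r) ^ r ≡ a
  frobenius-involutive a = ≡.trans (≡.sym (^-* a r r)) (fermat a)

module NetGeometry {r : ℕ} (F : FiniteField (r ℕ.* r)) where
  open FieldProperties F
  open Net r F
  open ≡.≡-Reasoning

  module _ (frobenius-+ : ∀ a b → (a + b) ^ r ≡ a ^ r + b ^ r) (frobenius-involutive : ∀ a → (a ^ r) ^ r ≡ a) where

    frobenius-* : ∀ a b → (a * b) ^ r ≡ a ^ r * b ^ r
    frobenius-* a b = ^-distrib-* a b r

    open Involution (_^ r) frobenius-+ frobenius-* frobenius-involutive

    module _ {n} (D : Reps (suc n)) (L : Line D) (x : Carrier) (x∉L : ¬ OnLine D L x) where
      open Reps D
      open Line L using () renaming (base to b; dir to e; dirS to e∈S)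

      g : Carrier
      g = x - b

      i₀ : Fin (suc n)
      i₀ = proj₁ e∈S

      c₀ : Carrier
      c₀ = proj₁ (proj₂ e∈S)

      c₀∈K : InSub c₀
      c₀∈K = proj₁ (proj₂ (proj₂ e∈S))

      c₀≢0 : c₀ ≢ 0#
      c₀≢0 = proj₁ (proj₂ (proj₂ (proj₂ e∈S)))

      e≡d₀c₀ : e ≡ d i₀ * c₀
      e≡d₀c₀ = proj₂ (proj₂ (proj₂ (proj₂ e∈S)))

      e≢0 : e ≢ 0#
      e≢0 e≡0 = *-≢0 (nonzero i₀) c₀≢0 (≡.trans (≡.sym e≡d₀c₀) e≡0)

      g∉eK : ∀ c → InSub c → g ≢ e * c
      g∉eK c c∈K g≡ec = x∉L (c , c∈K , (begin
        x              ≡⟨ solve 2 (λ x b → x := b :+ (x :- b)) ≡.refl x b ⟩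
        b + g          ≡⟨ ≡.cong (b +_) g≡ec ⟩
        b + e * c      ∎))

      open Coordinates e g e≢0 g∉eK

      V≡0⇒on-L : ∀ {z} → V (z - b) ≡ 0# → OnLine D L z
      V≡0⇒on-L {z} V≡0 = U (z - b) , U-fixed (z - b) , (begin
        z                                      ≡⟨ solve 2 (λ z b → z := b :+ (z :- b)) ≡.refl z b ⟩
        b + (z - b)                            ≡⟨ ≡.cong (b +_) (decompose (z - b)) ⟨
        b + (e * U (z - b) + g * V (z - b))    ≡⟨ ≡.cong (λ v → b + (e * U (z - b) + g * v)) V≡0 ⟩
        b + (e * U (z - b) + g * 0#)           ≡⟨ solve 3 (λ b a g → b :+ (a :+ g :* con (⁺ 0)) := b :+ a) ≡.refl b (e * U (z - b)) g ⟩
        b + e * U (z - b)                      ∎)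

      on-L⇒V≡0 : ∀ {z} → OnLine D L z → V (z - b) ≡ 0#
      on-L⇒V≡0 {z} (s , s∈K , ≡.refl) = proj₂ (coordinates-unique s∈K fixed-0
        (solve 4 (λ b e s g → b :+ e :* s :- b := e :* s :+ g :* con (⁺ 0)) ≡.refl b e s g))

      on-L? : ∀ z → Dec (OnLine D L z)
      on-L? z = Dec.map′ V≡0⇒on-L on-L⇒V≡0 (V (z - b) ≟ 0#)

      coordinates-scale : ∀ w {c} → InSub c → U (w * c) ≡ U w * c × V (w * c) ≡ V w * c
      coordinates-scale w {c} c∈K = coordinates-unique (fixed-* (U-fixed w) c∈K) (fixed-* (V-fixed w) c∈K) (begin
        w * c                          ≡⟨ ≡.cong (_* c) (decompose w) ⟨
        (e * U w + g * V w) * c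
          ≡⟨ solve 5 (λ e g u v c → (e :* u :+ g :* v) :* c := e :* (u :* c) :+ g :* (v :* c)) ≡.refl e g (U w) (V w) c ⟩
        e * (U w * c) + g * (V w * c)  ∎)

      -- The line x + w K meets L in b + e * intercept w (when V w ≢ 0#).
      intercept : Carrier → Carrier
      intercept w = - U w * V w ⁻¹

      intercept-coordinates : ∀ {u v} → InSub u → InSub v → intercept (e * u + g * v) ≡ - u * v ⁻¹
      intercept-coordinates {u} {v} u∈K v∈K =
        ≡.cong₂ (λ u v → - u * v ⁻¹) (proj₁ coordinates) (proj₂ coordinates)
        where
        coordinates : U (e * u + g * v) ≡ u × V (e * u + g * v) ≡ v
        coordinates = coordinates-unique u∈K v∈K ≡.refl

      intercept-scale : ∀ w {c} → InSub c → c ≢ 0# → intercept (w * c) ≡ intercept w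
      intercept-scale w {c} c∈K c≢0 = begin
        - U (w * c) * V (w * c) ⁻¹       ≡⟨ ≡.cong₂ (λ u v → - u * v ⁻¹) (proj₁ (coordinates-scale w c∈K)) (proj₂ (coordinates-scale w c∈K)) ⟩
        - (U w * c) * (V w * c) ⁻¹       ≡⟨ ≡.cong (λ i → - (U w * c) * i) (⁻¹-distrib-* (V w) c) ⟩
        - (U w * c) * (V w ⁻¹ * c ⁻¹)
          ≡⟨ solve 4 (λ u c v i → :- (u :* c) :* (v :* i) := :- u :* v :* (c :* i)) ≡.refl (U w) c (V w ⁻¹) (c ⁻¹) ⟩
        - U w * V w ⁻¹ * (c * c ⁻¹)      ≡⟨ ≡.cong (- U w * V w ⁻¹ *_) (⁻¹-inverseʳ c≢0) ⟩
        - U w * V w ⁻¹ * 1#              ≡⟨ *-identityʳ _ ⟩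
        intercept w                      ∎

      direction-intercept : ∀ {w} → V w ≢ 0# → w ≡ (g - e * intercept w) * V w
      direction-intercept {w} V≢0 = begin
        w                                          ≡⟨ decompose w ⟨
        e * U w + g * V w                          ≡⟨ ≡.cong (_+ g * V w) (*-identityʳ (e * U w)) ⟨
        e * U w * 1# + g * V w                     ≡⟨ ≡.cong (λ i → e * U w * i + g * V w) (⁻¹-inverseˡ V≢0) ⟨
        e * U w * (V w ⁻¹ * V w) + g * V w
          ≡⟨ solve 5 (λ e g u v i → e :* u :* (i :* v) :+ g :* v := (g :- e :* (:- u :* i)) :* v) ≡.refl e g (U w) (V w) (V w ⁻¹) ⟩
        (g - e * intercept w) * V w                ∎

      V-d₀≡0 : V (d i₀) ≡ 0#
      V-d₀≡0 = x*y≡0⇒x≡0 c₀≢0 (begin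
        V (d i₀) * c₀       ≡⟨ proj₂ (coordinates-scale (d i₀) c₀∈K) ⟨
        V (d i₀ * c₀)       ≡⟨ ≡.cong V e≡d₀c₀ ⟨
        V e                 ≡⟨ proj₂ (coordinates-unique fixed-1 fixed-0 (solve 2 (λ e g → e := e :* con (⁺ 1) :+ g :* con (⁺ 0)) ≡.refl e g)) ⟩
        0#                  ∎)

      V-d≡0⇒i₀ : ∀ {j} → V (d j) ≡ 0# → j ≡ i₀
      V-d≡0⇒i₀ {j} V≡0 = distinct j i₀ (c₀ * U (d j) , fixed-* c₀∈K (U-fixed (d j)) , *-≢0 c₀≢0 U≢0 , (begin
        d j                            ≡⟨ dj≡eU ⟩
        e * U (d j)                    ≡⟨ ≡.cong (_* U (d j)) e≡d₀c₀ ⟩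
        d i₀ * c₀ * U (d j)            ≡⟨ *-assoc _ _ _ ⟩
        d i₀ * (c₀ * U (d j))          ∎))
        where
        dj≡eU : d j ≡ e * U (d j)
        dj≡eU = begin
          d j                          ≡⟨ decompose (d j) ⟨
          e * U (d j) + g * V (d j)    ≡⟨ ≡.cong (λ v → e * U (d j) + g * v) V≡0 ⟩
          e * U (d j) + g * 0#         ≡⟨ solve 2 (λ a g → a :+ g :* con (⁺ 0) := a) ≡.refl (e * U (d j)) g ⟩
          e * U (d j)                  ∎
        U≢0 : U (d j) ≢ 0#
        U≢0 U≡0 = nonzero j (≡.trans dj≡eU (≡.trans (≡.cong (e *_) U≡0) (zeroʳ e)))

      d′ : Fin n → Carrier
      d′ i = d (punchIn i₀ i)

      V-d′≢0 : ∀ i → V (d′ i) ≢ 0#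
      V-d′≢0 i V≡0 = punchInᵢ≢i i₀ i (V-d≡0⇒i₀ V≡0)

      τ : Fin n → Carrier
      τ i = intercept (d′ i)

      τ-fixed : ∀ i → InSub (τ i)
      τ-fixed i = fixed-* (fixed-neg (U-fixed (d′ i))) (fixed-⁻¹ (V-fixed (d′ i)))

      τ-injective : Injective _≡_ _≡_ τ
      τ-injective {i} {j} τi≡τj = punchIn-injective i₀ i j (distinct _ _ (V (d′ j) ⁻¹ * V (d′ i) ,
        fixed-* (fixed-⁻¹ (V-fixed (d′ j))) (V-fixed (d′ i)) , *-≢0 (⁻¹-≢0 (V-d′≢0 j)) (V-d′≢0 i) , (begin
          d′ i                                        ≡⟨ direction-intercept (V-d′≢0 i) ⟩
          (g - e * τ i) * V (d′ i)                    ≡⟨ ≡.cong (λ s → (g - e * s) * V (d′ i)) τi≡τj ⟩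
          (g - e * τ j) * V (d′ i)                    ≡⟨ ≡.cong (_* V (d′ i)) (*-identityʳ _) ⟨
          (g - e * τ j) * 1# * V (d′ i)               ≡⟨ ≡.cong (λ c → (g - e * τ j) * c * V (d′ i)) (⁻¹-inverseʳ (V-d′≢0 j)) ⟨
          (g - e * τ j) * (V (d′ j) * V (d′ j) ⁻¹) * V (d′ i)
                                                      ≡⟨ solve 4 (λ a v w u → a :* (v :* w) :* u
                                                                  := a :* v :* (w :* u)) ≡.refl (g - e * τ j) (V (d′ j)) (V (d′ j) ⁻¹) (V (d′ i)) ⟩
          (g - e * τ j) * V (d′ j) * (V (d′ j) ⁻¹ * V (d′ i))
                                                      ≡⟨ ≡.cong (_* (V (d′ j) ⁻¹ * V (d′ i))) (direction-intercept (V-d′≢0 j)) ⟨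
          d′ j * (V (d′ j) ⁻¹ * V (d′ i))             ∎)))

      intercept∈τ : ∀ {w} → InS D w → V w ≢ 0# → ∃ λ i → τ i ≡ intercept w
      intercept∈τ {w} (j , c , c∈K , c≢0 , w≡djc) V≢0 = punchOut i₀≢j , (begin
        τ (punchOut i₀≢j)        ≡⟨ ≡.cong (intercept ∘ d) (punchIn-punchOut i₀≢j) ⟩
        intercept (d j)          ≡⟨ intercept-scale (d j) c∈K c≢0 ⟨
        intercept (d j * c)      ≡⟨ ≡.cong intercept w≡djc ⟨
        intercept w              ∎)
        where
        i₀≢j : i₀ ≢ j
        i₀≢j ≡.refl = V≢0 (begin
          V w              ≡⟨ ≡.cong V w≡djc ⟩
          V (d i₀ * c)     ≡⟨ proj₂ (coordinates-scale (d i₀) c∈K) ⟩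
          V (d i₀) * c     ≡⟨ ≡.cong (_* c) V-d₀≡0 ⟩
          0# * c           ≡⟨ zeroˡ c ⟩
          0#               ∎)

      a : Fin n → Carrier
      a i = b + e * τ i

      a∈A : ∀ i → InA D x L (a i)
      a∈A i = inj₂ (x≢a , punchIn i₀ i , V (d′ i) ⁻¹ , fixed-⁻¹ (V-fixed (d′ i)) , ⁻¹-≢0 (V-d′≢0 i) , x-a≡) , a-on-L
        where
        a-on-L : OnLine D L (a i)
        a-on-L = τ i , τ-fixed i , ≡.refl
        x≢a : x ≢ a i
        x≢a x≡a = x∉L (≡.subst (OnLine D L) (≡.sym x≡a) a-on-L)
        x-a≡ : x - a i ≡ d′ i * V (d′ i) ⁻¹
        x-a≡ = begin
          x - (b + e * τ i)                            ≡⟨ solve 4 (λ x b e t → x :- (b :+ e :* t) := (x :- b) :- e :* t) ≡.refl x b e (τ i) ⟩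
          (g - e * τ i)                                ≡⟨ *-identityʳ _ ⟨
          (g - e * τ i) * 1#                           ≡⟨ ≡.cong ((g - e * τ i) *_) (⁻¹-inverseʳ (V-d′≢0 i)) ⟨
          (g - e * τ i) * (V (d′ i) * V (d′ i) ⁻¹)     ≡⟨ *-assoc _ _ _ ⟨
          (g - e * τ i) * V (d′ i) * V (d′ i) ⁻¹       ≡⟨ ≡.cong (_* V (d′ i) ⁻¹) (direction-intercept (V-d′≢0 i)) ⟨
          d′ i * V (d′ i) ⁻¹                           ∎

      adjacent-parameter∈τ : ∀ {s} → InSub s → InS D (x - (b + e * s)) → ∃ λ i → τ i ≡ s
      adjacent-parameter∈τ {s} s∈K x~y = map₂ (λ τi≡ → ≡.trans τi≡ intercept≡s) (intercept∈τ x~y V≢0)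
        where
        coordinates : x - (b + e * s) ≡ e * - s + g * 1#
        coordinates = solve 4 (λ x b e s → x :- (b :+ e :* s) := e :* (:- s) :+ (x :- b) :* con (⁺ 1)) ≡.refl x b e s
        V≢0 : V (x - (b + e * s)) ≢ 0#
        V≢0 = ≡.subst (_≢ 0#) (≡.sym (proj₂ (coordinates-unique (fixed-neg s∈K) fixed-1 coordinates))) 1≢0
        intercept≡s : intercept (x - (b + e * s)) ≡ s
        intercept≡s = begin
          intercept (x - (b + e * s))      ≡⟨ ≡.cong intercept coordinates ⟩
          intercept (e * - s + g * 1#)     ≡⟨ intercept-coordinates (fixed-neg s∈K) fixed-1 ⟩
          - - s * 1# ⁻¹                    ≡⟨ ≡.cong₂ _*_ (-‿involutive s) 1⁻¹ ⟩
          s * 1#                           ≡⟨ *-identityʳ s ⟩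
          s                                ∎

      module OffLine (z : Carrier) (z∉L : ¬ OnLine D L z) (z-a∈S : ∀ i → InS D (z - a i)) where

        u v : Carrier
        u = U (z - b)
        v = V (z - b)

        v≢0 : v ≢ 0#
        v≢0 = z∉L ∘ V≡0⇒on-L

        z≡b+eu+gv : z ≡ b + (e * u + g * v)
        z≡b+eu+gv = ≡.trans (solve 2 (λ z b → z := b :+ (z :- b)) ≡.refl z b) (≡.cong (b +_) (≡.sym (decompose (z - b))))

        -- The parallel to z (a i) through x meets L in the point of A with parameter projection (τ i).
        projection : Carrier → Carrier
        projection s = v ⁻¹ * s + - u * v ⁻¹

        projection-closed : Closed τ projection
        projection-closed i = map₂ (λ τj≡ → ≡.trans τj≡ intercept≡) (intercept∈τ (z-a∈S i) V≢0)
          where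
          coordinates : z - a i ≡ e * (u - τ i) + g * v
          coordinates = begin
            z - (b + e * τ i)                   ≡⟨ ≡.cong (λ y → y - (b + e * τ i)) z≡b+eu+gv ⟩
            b + (e * u + g * v) - (b + e * τ i)
              ≡⟨ solve 6 (λ b e g u v t → b :+ (e :* u :+ g :* v) :- (b :+ e :* t) := e :* (u :- t) :+ g :* v) ≡.refl b e g u v (τ i) ⟩
            e * (u - τ i) + g * v               ∎
          u-τ∈K : InSub (u - τ i)
          u-τ∈K = fixed-- (U-fixed (z - b)) (τ-fixed i)
          V≢0 : V (z - a i) ≢ 0#
          V≢0 = ≡.subst (_≢ 0#) (≡.sym (proj₂ (coordinates-unique u-τ∈K (V-fixed (z - b)) coordinates))) v≢0
          intercept≡ : intercept (z - a i) ≡ v ⁻¹ * τ i + - u * v ⁻¹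
          intercept≡ = begin
            intercept (z - a i)                 ≡⟨ ≡.cong intercept coordinates ⟩
            intercept (e * (u - τ i) + g * v)   ≡⟨ intercept-coordinates u-τ∈K (V-fixed (z - b)) ⟩
            - (u - τ i) * v ⁻¹                  ≡⟨ solve 3 (λ u t w → :- (u :- t) :* w := w :* t :+ :- u :* w) ≡.refl u (τ i) (v ⁻¹) ⟩
            v ⁻¹ * τ i + - u * v ⁻¹             ∎

        translation-case : n · 1# ≢ 0# → v ≡ 1# → z ≡ x
        translation-case n≢0 v≡1 = begin
          z                          ≡⟨ z≡b+eu+gv ⟩
          b + (e * u + g * v)        ≡⟨ ≡.cong₂ (λ u v → b + (e * u + g * v)) u≡0 v≡1 ⟩
          b + (e * 0# + g * 1#)      ≡⟨ solve 3 (λ x b e → b :+ (e :* con (⁺ 0) :+ (x :- b) :* con (⁺ 1)) := x) ≡.refl x b e ⟩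
          x                          ∎
          where
          shift : ∀ s → v ⁻¹ * s + - u * v ⁻¹ ≡ - u + s
          shift s = begin
            v ⁻¹ * s + - u * v ⁻¹    ≡⟨ ≡.cong (λ w → w * s + - u * w) (≡.trans (≡.cong _⁻¹ v≡1) 1⁻¹) ⟩
            1# * s + - u * 1#        ≡⟨ solve 2 (λ s u → con (⁺ 1) :* s :+ :- u :* con (⁺ 1) := :- u :+ s) ≡.refl s u ⟩
            - u + s                  ∎
          u≡0 : u ≡ 0#
          u≡0 = ≡.trans (≡.sym (-‿involutive u))
                  (≡.trans (≡.cong -_ (n·δ≡0⇒δ≡0 {n} n≢0 (translation-closed⇒n·δ≡0 τ-injective (Closed-cong shift projection-closed)))) -0#≈0#)

        -- The line through x and z is its own parallel, so its intercept τ k is fixed by the projection.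
        dilation-case : InS D (x - z) → v ≢ 1# → v ⁻¹ ^ (n ∸ 1) ≡ 1#
        dilation-case x-z∈S v≢1 = affine-closed⇒μⁿ⁻¹≡1 (proj₁ hit) τ-injective (⁻¹-≢0 v≢0) projection-closed (begin
          v ⁻¹ * τ k + - u * v ⁻¹            ≡⟨ ≡.cong (λ c → v ⁻¹ * τ k + - c * v ⁻¹) u≡τk[1-v] ⟩
          v ⁻¹ * τ k + - (τ k * (1# - v)) * v ⁻¹
                                             ≡⟨ solve 3 (λ t v w → w :* t :+ :- (t :* (con (⁺ 1) :- v)) :* w
                                                         := t :* (v :* w)) ≡.refl (τ k) v (v ⁻¹) ⟩
          τ k * (v * v ⁻¹)                   ≡⟨ ≡.cong (τ k *_) (⁻¹-inverseʳ v≢0) ⟩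
          τ k * 1#                           ≡⟨ *-identityʳ (τ k) ⟩
          τ k                                ∎)
          where
          1-v≢0 : 1# - v ≢ 0#
          1-v≢0 = v≢1 ∘ ≡.sym ∘ x-y≡0⇒x≡y
          coordinates : x - z ≡ e * - u + g * (1# - v)
          coordinates = begin
            x - z                         ≡⟨ ≡.cong (_-_ x) z≡b+eu+gv ⟩
            x - (b + (e * u + g * v))
              ≡⟨ solve 5 (λ x b e u v → x :- (b :+ (e :* u :+ (x :- b) :* v)) := e :* (:- u) :+ (x :- b) :* (con (⁺ 1) :- v)) ≡.refl x b e u v ⟩
            e * - u + g * (1# - v)        ∎
          -u∈K : InSub (- u)
          -u∈K = fixed-neg (U-fixed (z - b))
          1-v∈K : InSub (1# - v)
          1-v∈K = fixed-- fixed-1 (V-fixed (z - b))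
          V≢0 : V (x - z) ≢ 0#
          V≢0 = ≡.subst (_≢ 0#) (≡.sym (proj₂ (coordinates-unique -u∈K 1-v∈K coordinates))) 1-v≢0
          hit : ∃ λ k → τ k ≡ intercept (x - z)
          hit = intercept∈τ x-z∈S V≢0
          k : Fin n
          k = proj₁ hit
          u≡τk[1-v] : u ≡ τ k * (1# - v)
          u≡τk[1-v] = begin
            u                                     ≡⟨ *-identityʳ u ⟨
            u * 1#                                ≡⟨ ≡.cong (u *_) (⁻¹-inverseˡ 1-v≢0) ⟨
            u * ((1# - v) ⁻¹ * (1# - v))          ≡⟨ solve 3 (λ u i w → u :* (i :* w) := :- (:- u) :* i :* w) ≡.refl u ((1# - v) ⁻¹) (1# - v) ⟩
            - - u * (1# - v) ⁻¹ * (1# - v)        ≡⟨ ≡.cong (_* (1# - v)) (intercept-coordinates -u∈K 1-v∈K) ⟨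
            intercept (e * - u + g * (1# - v)) * (1# - v)
                                                  ≡⟨ ≡.cong (λ w → intercept w * (1# - v)) coordinates ⟨
            intercept (x - z) * (1# - v)          ≡⟨ ≡.cong (_* (1# - v)) (proj₂ hit) ⟨
            τ k * (1# - v)                        ∎

        -- Composing the projection with the reflection of L through 0 = b + e t₁ gives a translation.
        reflection-case : n · 1# ≢ 0# → ∀ {t₁} → 0# ≡ b + e * t₁ → Closed τ (λ s → (t₁ + t₁) - s) → v ≡ - 1# → z ≡ - x
        reflection-case n≢0 {t₁} 0≡b+et₁ reflection-closed v≡-1 = begin
          z                                  ≡⟨ z≡b+eu+gv ⟩
          b + (e * u + g * v)                ≡⟨ ≡.cong₂ (λ u v → b + (e * u + g * v)) u≡t₁+t₁ v≡-1 ⟩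
          b + (e * (t₁ + t₁) + g * - 1#)
            ≡⟨ solve 4 (λ x b e t → b :+ (e :* (t :+ t) :+ (x :- b) :* (:- con (⁺ 1)))
                        := :- x :+ (b :+ e :* t) :+ (b :+ e :* t)) ≡.refl x b e t₁ ⟩
          - x + (b + e * t₁) + (b + e * t₁)  ≡⟨ ≡.cong (λ o → - x + o + o) 0≡b+et₁ ⟨
          - x + 0# + 0#                      ≡⟨ solve 1 (λ x → :- x :+ con (⁺ 0) :+ con (⁺ 0) := :- x) ≡.refl x ⟩
          - x                                ∎
          where
          v⁻¹≡-1 : v ⁻¹ ≡ - 1#
          v⁻¹≡-1 = ≡.trans (≡.cong _⁻¹ v≡-1) (≡.trans (⁻¹-neg 1#) (≡.cong -_ 1⁻¹))
          shift : ∀ s → v ⁻¹ * ((t₁ + t₁) - s) + - u * v ⁻¹ ≡ (u - (t₁ + t₁)) + s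
          shift s = begin
            v ⁻¹ * ((t₁ + t₁) - s) + - u * v ⁻¹     ≡⟨ ≡.cong (λ w → w * ((t₁ + t₁) - s) + - u * w) v⁻¹≡-1 ⟩
            - 1# * ((t₁ + t₁) - s) + - u * - 1#
              ≡⟨ solve 3 (λ t s u → :- con (⁺ 1) :* ((t :+ t) :- s) :+ :- u :* (:- con (⁺ 1)) := (u :- (t :+ t)) :+ s) ≡.refl t₁ s u ⟩
            (u - (t₁ + t₁)) + s                     ∎
          u≡t₁+t₁ : u ≡ t₁ + t₁
          u≡t₁+t₁ = x-y≡0⇒x≡y (n·δ≡0⇒δ≡0 {n} n≢0 (translation-closed⇒n·δ≡0 τ-injective
                      (Closed-cong shift (Closed-∘ {f = λ s → (t₁ + t₁) - s} {projection} reflection-closed projection-closed))))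

      A⇒x-adjacent : ∀ {y} → InA D x L y → InS D (x - y)
      A⇒x-adjacent (inj₁ y≡x , y∈L) = contradiction (≡.subst (OnLine D L) y≡x y∈L) x∉L
      A⇒x-adjacent (inj₂ x~y , _)   = proj₂ x~y

      reflection-closed : ∀ {t₁} → InSub t₁ → 0# ≡ b + e * t₁ → (∀ y → InA D x L y → InA D x L (- y)) →
                          Closed τ (λ s → (t₁ + t₁) - s)
      reflection-closed {t₁} t₁∈K 0≡b+et₁ A-symmetric i =
        adjacent-parameter∈τ (fixed-- (fixed-+ t₁∈K t₁∈K) (τ-fixed i)) (≡.subst (λ y → InS D (x - y)) -a≡ x+a∈S)
        where
        -a≡ : - a i ≡ b + e * ((t₁ + t₁) - τ i)
        -a≡ = begin
          - (b + e * τ i)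
            ≡⟨ solve 4 (λ b e t s → :- (b :+ e :* s) := b :+ e :* ((t :+ t) :- s) :- ((b :+ e :* t) :+ (b :+ e :* t))) ≡.refl b e t₁ (τ i) ⟩
          b + e * ((t₁ + t₁) - τ i) - ((b + e * t₁) + (b + e * t₁))       ≡⟨ ≡.cong (λ o → b + e * ((t₁ + t₁) - τ i) - (o + o)) 0≡b+et₁ ⟨
          b + e * ((t₁ + t₁) - τ i) - (0# + 0#)
            ≡⟨ solve 1 (λ y → y :- (con (⁺ 0) :+ con (⁺ 0)) := y) ≡.refl (b + e * ((t₁ + t₁) - τ i)) ⟩
          b + e * ((t₁ + t₁) - τ i)                                       ∎
        x+a∈S : InS D (x - - a i)
        x+a∈S = A⇒x-adjacent (A-symmetric (a i) (a∈A i))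

      module Clique {C : Carrier → Set} (C-clique : IsClique D C) (x∪A⊆C : ∀ z → z ≡ x ⊎ InA D x L z → C z) where

        x∈C : C x
        x∈C = x∪A⊆C x (inj₁ ≡.refl)

        on-L-member : ∀ {z} → C z → z ≢ x → OnLine D L z → InA D x L z
        on-L-member {z} z∈C z≢x z∈L = inj₂ (C-clique x z x∈C z∈C (z≢x ∘ ≡.sym)) , z∈L

        module OffLineMember {z : Carrier} (z∈C : C z) (z≢x : z ≢ x) (z∉L : ¬ OnLine D L z) where

          z-a∈S : ∀ i → InS D (z - a i)
          z-a∈S i = proj₂ (C-clique z (a i) z∈C (x∪A⊆C (a i) (inj₂ (a∈A i))) z≢a)
            where
            z≢a : z ≢ a i
            z≢a z≡a = z∉L (≡.subst (OnLine D L) (≡.sym z≡a) (proj₂ (a∈A i)))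

          open OffLine z z∉L z-a∈S public

          v≢1 : n · 1# ≢ 0# → v ≢ 1#
          v≢1 n≢0 = z≢x ∘ translation-case n≢0

          v⁻¹≢1 : n · 1# ≢ 0# → v ⁻¹ ≢ 1#
          v⁻¹≢1 n≢0 v⁻¹≡1 = v≢1 n≢0 (≡.trans (≡.sym (⁻¹-involutive v)) (≡.trans (≡.cong _⁻¹ v⁻¹≡1) 1⁻¹))

          v⁻¹-root : n · 1# ≢ 0# → v ⁻¹ ^ gcd (r ∸ 1) (n ∸ 1) ≡ 1#
          v⁻¹-root n≢0 = ^-gcd≡1 (r ∸ 1) (n ∸ 1) (^-pred≡1 r (⁻¹-≢0 v≢0) (fixed-⁻¹ (V-fixed (z - b))))
                           (dilation-case (proj₂ (C-clique x z x∈C z∈C (z≢x ∘ ≡.sym))) (v≢1 n≢0))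

          gcd≡1-absurd : n · 1# ≢ 0# → gcd (r ∸ 1) (n ∸ 1) ≡ 1 → ⊥
          gcd≡1-absurd n≢0 gcd≡1 = v⁻¹≢1 n≢0 (≡.trans (≡.sym (*-identityʳ (v ⁻¹))) (≡.subst (λ k → v ⁻¹ ^ k ≡ 1#) gcd≡1 (v⁻¹-root n≢0)))

          v≡-1 : n · 1# ≢ 0# → gcd (r ∸ 1) (n ∸ 1) ≡ 2 → v ≡ - 1#
          v≡-1 n≢0 gcd≡2 = ≡.trans (≡.sym (⁻¹-involutive v)) (≡.trans (≡.cong _⁻¹ v⁻¹≡-1) (≡.trans (⁻¹-neg 1#) (≡.cong -_ 1⁻¹)))
            where
            v⁻¹² : v ⁻¹ * v ⁻¹ ≡ 1#
            v⁻¹² = ≡.trans (≡.cong (v ⁻¹ *_) (≡.sym (*-identityʳ (v ⁻¹)))) (≡.subst (λ k → v ⁻¹ ^ k ≡ 1#) gcd≡2 (v⁻¹-root n≢0))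
            v⁻¹≡-1 : v ⁻¹ ≡ - 1#
            v⁻¹≡-1 = case x*x≡1⇒x≡±1 v⁻¹² of λ where
              (inj₁ v⁻¹≡1)  → contradiction v⁻¹≡1 (v⁻¹≢1 n≢0)
              (inj₂ v⁻¹≡-1) → v⁻¹≡-1

        member-gcd₁ : n · 1# ≢ 0# → gcd (r ∸ 1) (n ∸ 1) ≡ 1 → ∀ {z} → C z → z ≡ x ⊎ InA D x L z
        member-gcd₁ n≢0 gcd≡1 {z} z∈C = case (z ≟ x) of λ where
          (yes z≡x) → inj₁ z≡x
          (no z≢x)  → case on-L? z of λ where
            (yes z∈L) → inj₂ (on-L-member z∈C z≢x z∈L)
            (no z∉L)  → ⊥-elim (OffLineMember.gcd≡1-absurd z∈C z≢x z∉L n≢0 gcd≡1)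

        module Symmetric (A-symmetric : ∀ y → InA D x L y → InA D x L (- y)) (0∈A : InA D x L 0#) where

          t₁ : Carrier
          t₁ = proj₁ (proj₂ 0∈A)

          t₁∈K : InSub t₁
          t₁∈K = proj₁ (proj₂ (proj₂ 0∈A))

          0≡b+et₁ : 0# ≡ b + e * t₁
          0≡b+et₁ = proj₂ (proj₂ (proj₂ 0∈A))

          member-gcd₂ : n · 1# ≢ 0# → gcd (r ∸ 1) (n ∸ 1) ≡ 2 → ∀ {z} → C z → z ≡ x ⊎ z ≡ - x ⊎ InA D x L z
          member-gcd₂ n≢0 gcd≡2 {z} z∈C = case (z ≟ x) of λ where
            (yes z≡x) → inj₁ z≡x
            (no z≢x)  → case on-L? z of λ where
              (yes z∈L) → inj₂ (inj₂ (on-L-member z∈C z≢x z∈L))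
              (no z∉L)  → let open OffLineMember z∈C z≢x z∉L in
                inj₂ (inj₁ (reflection-case n≢0 0≡b+et₁ (reflection-closed t₁∈K 0≡b+et₁ A-symmetric) (v≡-1 n≢0 gcd≡2)))

          x+x∈S : x ≢ - x → InS D (x - - x)
          x+x∈S x≢-x = doubling (A⇒x-adjacent 0∈A)
            where
            x+x≡[x-0]2 : x - - x ≡ (x - 0#) * (1# + 1#)
            x+x≡[x-0]2 = solve 1 (λ x → x :- (:- x) := (x :- con (⁺ 0)) :* (con (⁺ 1) :+ con (⁺ 1))) ≡.refl x
            2≢0 : 1# + 1# ≢ 0#
            2≢0 2≡0 = x≢-x (x-y≡0⇒x≡y (≡.trans x+x≡[x-0]2 (≡.trans (≡.cong ((x - 0#) *_) 2≡0) (zeroʳ _))))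
            doubling : InS D (x - 0#) → InS D (x - - x)
            doubling (j , c , c∈K , c≢0 , x-0≡djc) =
              j , c * (1# + 1#) , fixed-* c∈K (fixed-+ fixed-1 fixed-1) , *-≢0 c≢0 2≢0 , (begin
                x - - x                   ≡⟨ x+x≡[x-0]2 ⟩
                (x - 0#) * (1# + 1#)      ≡⟨ ≡.cong (_* (1# + 1#)) x-0≡djc ⟩
                d j * c * (1# + 1#)       ≡⟨ *-assoc _ _ _ ⟩
                d j * (c * (1# + 1#))     ∎)

          -x∈C : (∀ z → (∀ y → C y → y ≢ z → Adj D y z) → C z) → n · 1# ≢ 0# → gcd (r ∸ 1) (n ∸ 1) ≡ 2 → C (- x)
          -x∈C maximal n≢0 gcd≡2 = case (x ≟ - x) of λ where
            (yes x≡-x) → ≡.subst C x≡-x x∈C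
            (no x≢-x)  → maximal (- x) λ y y∈C y≢-x → case member-gcd₂ n≢0 gcd≡2 y∈C of λ where
              (inj₁ y≡x)        → ≡.subst (λ y → Adj D y (- x)) (≡.sym y≡x) (x≢-x , x+x∈S x≢-x)
              (inj₂ (inj₁ y≡-x)) → contradiction y≡-x y≢-x
              (inj₂ (inj₂ y∈A))  → y≢-x , ≡.subst (InS D) (solve 2 (λ x y → x :- (:- y) := y :- (:- x)) ≡.refl x y)
                                                   (A⇒x-adjacent (A-symmetric y y∈A))

      maximal-clique-gcd₁ : n · 1# ≢ 0# → gcd (r ∸ 1) (n ∸ 1) ≡ 1 →
                            ∀ C → IsMaximalClique D C → (∀ z → z ≡ x ⊎ InA D x L z → C z) →
                            _≐_ D C (λ z → z ≡ x ⊎ InA D x L z)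
      maximal-clique-gcd₁ n≢0 gcd≡1 C (C-clique , _) x∪A⊆C z = member-gcd₁ n≢0 gcd≡1 , x∪A⊆C z
        where open Clique C-clique x∪A⊆C

      maximal-clique-gcd₂ : n · 1# ≢ 0# → gcd (r ∸ 1) (n ∸ 1) ≡ 2 →
                            (∀ z → InA D x L z → InA D x L (- z)) → InA D x L 0# →
                            ∀ C → IsMaximalClique D C → (∀ z → z ≡ x ⊎ InA D x L z → C z) →
                            _≐_ D C (λ z → z ≡ x ⊎ z ≡ - x ⊎ InA D x L z)
      maximal-clique-gcd₂ n≢0 gcd≡2 A-symmetric 0∈A C (C-clique , maximal) x∪A⊆C z = member-gcd₂ n≢0 gcd≡2 , λ where
          (inj₁ z≡x)         → x∪A⊆C z (inj₁ z≡x)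
          (inj₂ (inj₁ z≡-x)) → ≡.subst C (≡.sym z≡-x) (-x∈C maximal n≢0 gcd≡2)
          (inj₂ (inj₂ z∈A))  → x∪A⊆C z (inj₂ z∈A)
        where
        open Clique C-clique x∪A⊆C
        open Symmetric A-symmetric 0∈A

-- Opened only now: in the modules above, _*_ and _^_ are the field operations.
open import Data.Nat using (_*_; _^_; _<_)

corollary10 :
    (p r m : ℕ) → Prime p → (∃ λ k → r ≡ p ^ suc k) →
    2 < m → m < r ∸ 1 → ¬ (p ∣ m ∸ 1) →
    (F : FiniteField (r * r)) →
    let open FiniteField F
        open Net r F
    in (D : Reps m) → (L : Line D) → (x : Carrier) → ¬ OnLine D L x →
       (gcd (r ∸ 1) (m ∸ 2) ≡ 1 →
          ∀ (C : Carrier → Set) → IsMaximalClique D C →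
          (∀ z → (z ≡ x ⊎ InA D x L z) → C z) →
          _≐_ D C (λ z → z ≡ x ⊎ InA D x L z))
       ×
       (gcd (r ∸ 1) (m ∸ 2) ≡ 2 →
          (∀ z → OnLine D L z → OnLine D L (- z)) →
          (∀ z → InA D x L z → InA D x L (- z)) →
          InA D x L 0# →
          ∀ (C : Carrier → Set) → IsMaximalClique D C →
          (∀ z → (z ≡ x ⊎ InA D x L z) → C z) →
          _≐_ D C (λ z → z ≡ x ⊎ z ≡ - x ⊎ InA D x L z))
corollary10 p r (suc n) p-prime (k , r≡pᵏ⁺¹) _ _ p∤n F D L x x∉L =
  maximal-clique-gcd₁ frobenius-+ frobenius-involutive D L x x∉L n·1≢0 ,
  λ gcd≡2 _ → maximal-clique-gcd₂ frobenius-+ frobenius-involutive D L x x∉L n·1≢0 gcd≡2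
  where
  open FieldProperties F
  open FrobeniusOfSquareOrder {k = k} p-prime r≡pᵏ⁺¹ F
  open NetGeometry {r} F
  n·1≢0 : n · 1# ≢ 0#
  n·1≢0 = p∤n⇒n·1≢0 p-prime characteristic-p p∤n
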